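{- Let $\mathsf{M}$ be a connected split matroid on ground set $E$ without loops and coloops. Assume that for every $e\in E$, the contraction $\mathsf{M}/\{e\}$ or the deletion $\mathsf{M}\setminus\{e\}$ has a loop or a coloop. Then at least one of the following holds: (i) the rank or the corank of $\mathsf{M}$ is $1$ or $2$; (ii) $\mathsf{M}$ is isomorphic to a minimal matroid $\mathsf{T}_{k,n}$ for some $k,n$.
   Context: A cyclic flat of a matroid is a flat that is a union of circuits. A connected split matroid is a connected matroid $\mathsf{M}$ on ground set $E$ whose proper cyclic flats form a clutter: whenever $F_1\subsetneq F_2$ are cyclic flats of $\mathsf{M}$, either $F_1=\varnothing$ or $F_2=E$. The corank of a matroid of rank $k$ on ground set $E$ is $|E|-k$. The minimal matroid $\mathsf{T}_{k,n}$ is the graphic matroid (of rank $k$ on $n$ elements) of the graph obtained from a cycle of length $k+1$ by replacing one edge by $n-k$ parallel copies of that edge. -}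

module Defs where

open import Data.Nat using (ℕ; zero; suc; _+_; _∸_; _≤_; _<_; _<?_; _≤ᵇ_)
open import Data.Nat.Properties using (m<n⇒m<1+n)
open import Data.Bool using (Bool; true; false; _∧_; _∨_; if_then_else_)
open import Data.Fin using (Fin; toℕ; fromℕ; fromℕ<; _≟_)
open import Data.Fin.Subset using (Subset; _∈_; _∉_; _⊆_; _⊂_; _∪_; _∩_; _-_; ∣_∣; ⁅_⁆; ⊤; ⊥)
open import Data.Vec using (Vec; tabulate; lookup; count)
open import Data.Product using (Σ; _×_; _,_; ∃)
open import Data.Sum using (_⊎_)
open import Relation.Nullary using (¬_; yes; no)
open import Relation.Nullary.Decidable using (⌊_⌋)
open import Relation.Binary.PropositionalEquality using (_≡_)
open import Function.Bundles using (_↔_; Inverse)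

record Matroid (n : ℕ) : Set where
  field
    rk        : Subset n → ℕ
    rk-card   : ∀ X → rk X ≤ ∣ X ∣
    rk-mono   : ∀ X Y → X ⊆ Y → rk X ≤ rk Y
    rk-submod : ∀ X Y → rk (X ∪ Y) + rk (X ∩ Y) ≤ rk X + rk Y

open Matroid public

-- "Set systems with a rank function": a ground set E ⊆ Fin n together with
-- a rank function (only its values on subsets of E matter).  Used to talk
-- about minors M / e and M \ e without re-indexing the ground set.

record RankData (n : ℕ) : Set where
  constructor ⟨_,_⟩
  field
    ground : Subset n
    rank   : Subset n → ℕ

open RankData public

toData : ∀ {n} → Matroid n → RankData n
toData M = ⟨ ⊤ , rk M ⟩

module _ {n : ℕ} (D : RankData n) where

  Independent : Subset n → Set
  Independent X = X ⊆ ground D × rank D X ≡ ∣ X ∣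

  Dependent : Subset n → Set
  Dependent X = X ⊆ ground D × rank D X < ∣ X ∣

  Basis : Subset n → Set
  Basis B = Independent B × (∀ Y → Independent Y → B ⊆ Y → Y ≡ B)

  Circuit : Subset n → Set
  Circuit C = Dependent C × (∀ D → D ⊂ C → Independent D)

  Loop : Fin n → Set
  Loop e = e ∈ ground D × Dependent ⁅ e ⁆

  Coloop : Fin n → Set
  Coloop e = e ∈ ground D × (∀ B → Basis B → e ∈ B)

  HasLoopOrColoop : Set
  HasLoopOrColoop = ∃ λ e → Loop e ⊎ Coloop e

  Flat : Subset n → Set
  Flat F = F ⊆ ground D × (∀ e → e ∈ ground D → e ∉ F → rank D F < rank D (F ∪ ⁅ e ⁆))

  Cyclic : Subset n → Set
  Cyclic F = F ⊆ ground D × (∀ e → e ∈ F → ∃ λ C → Circuit C × e ∈ C × C ⊆ F)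

  CyclicFlat : Subset n → Set
  CyclicFlat F = Flat F × Cyclic F

  Connected : Set
  Connected = ∀ e f → e ∈ ground D → f ∈ ground D → ¬ e ≡ f →
              ∃ λ C → Circuit C × e ∈ C × f ∈ C

  -- proper cyclic flats form a clutter
  SplitCond : Set
  SplitCond = ∀ F₁ F₂ → CyclicFlat F₁ → CyclicFlat F₂ → F₁ ⊂ F₂ →
              (F₁ ≡ ⊥) ⊎ (F₂ ≡ ground D)

delete : ∀ {n} → RankData n → Fin n → RankData n
delete D e = ⟨ ground D - e , rank D ⟩

contract : ∀ {n} → RankData n → Fin n → RankData n
contract D e = ⟨ ground D - e , (λ X → rank D (X ∪ ⁅ e ⁆) ∸ rank D ⁅ e ⁆) ⟩

ConnectedSplit : ∀ {n} → Matroid n → Set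
ConnectedSplit M = Connected (toData M) × SplitCond (toData M)

rankOf : ∀ {n} → Matroid n → ℕ
rankOf M = rk M ⊤

corankOf : ∀ {n} → Matroid n → ℕ
corankOf {n} M = n ∸ rk M ⊤

-- Graphic matroids of (multi)graphs with vertex set Fin V and edge set
-- Fin m, edge j having endpoints ends j.  rank X = V − (#components of
-- the spanning subgraph (Fin V, X)).

anyFin : ∀ m → (Fin m → Bool) → Bool
anyFin zero    p = false
anyFin (suc m) p = p Fin.zero ∨ anyFin m (λ j → p (Fin.suc j))
  where import Data.Fin as Fin

allFin : ∀ m → (Fin m → Bool) → Bool
allFin zero    p = true
allFin (suc m) p = p Fin.zero ∧ allFin m (λ j → p (Fin.suc j))
  where import Data.Fin as Fin

module Graphic {V m : ℕ} (ends : Fin m → Fin V × Fin V) where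

  _==_ : Fin V → Fin V → Bool
  a == b = ⌊ a ≟ b ⌋

  adj : Subset m → Subset V → Fin V → Bool
  adj X R w = anyFin m λ j → lookup X j ∧ edgeTo (ends j)
    where
    edgeTo : Fin V × Fin V → Bool
    edgeTo (a , b) = (lookup R a ∧ (b == w)) ∨ (lookup R b ∧ (a == w))

  step : Subset m → Subset V → Subset V
  step X R = tabulate λ w → lookup R w ∨ adj X R w

  iter : ℕ → Subset m → Subset V → Subset V
  iter zero    X R = R
  iter (suc k) X R = step X (iter k X R)

  component : Subset m → Fin V → Subset V
  component X v = iter V X ⁅ v ⁆

  isRoot : Subset m → Fin V → Bool
  isRoot X v = allFin V λ w → if lookup (component X v) w then toℕ v ≤ᵇ toℕ w else true

  components : Subset m → ℕ
  components X = count (λ b → b Data.Bool.≟ true) (tabulate (isRoot X))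
    where import Data.Bool

  graphicRank : Subset m → ℕ
  graphicRank X = V ∸ components X

-- The minimal matroid T_{k,m}: vertices 0..k form a cycle of length k+1
-- with edges (i,i+1) for i < k and the edge (k,0); the edge (k,0) is
-- replaced by m − k parallel copies.  Edges j with j < k are the path
-- edges (j, j+1); edges j with k ≤ j < m are the parallel copies of (k,0).

T-ends : (k m : ℕ) → Fin m → Fin (suc k) × Fin (suc k)
T-ends k m j with toℕ j <? k
... | yes p = fromℕ< (m<n⇒m<1+n p) , fromℕ< (Data.Nat.s≤s p)
  where import Data.Nat
... | no _  = fromℕ k , Data.Fin.zero
  where import Data.Fin

T-rank : (k m : ℕ) → Subset m → ℕ
T-rank k m = Graphic.graphicRank (T-ends k m)

image : ∀ {n m} → Fin n ↔ Fin m → Subset n → Subset m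
image σ X = tabulate λ y → lookup X (Inverse.from σ y)

IsoToRank : ∀ {n m} → Matroid n → (Subset m → ℕ) → Set
IsoToRank {n} {m} M r = Σ (Fin n ↔ Fin m) λ σ → ∀ X → r (image σ X) ≡ rk M X

-- Without loops and coloops, the minor condition says that every element has a parallel or a series
-- mate. Two non-parallel elements with parallel mates would make their parallel classes, and the closure
-- of their union, nested proper cyclic flats, so splitness forces rank ≤ 2. Applied to the dual, the same
-- argument gives corank ≤ 2 if no element has a parallel mate. So when rank and corank are at least 3,
-- there is a unique non-trivial parallel class P; every element outside P has a series mate, and
-- splitness (for the complement of a series class) makes the elements outside P pairwise in series.
-- Then S = E ∖ P is a basis and r X = |X ∩ S| + [X meets P and S ⊈ X], which is the rank function of
-- T_{r(E),|E|} with path edges S.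

{-# OPTIONS --safe #-}
module Submission where

import Data.Bool
open import Data.Bool using (Bool; true; false; _∧_; _∨_; not; T; if_then_else_)
open import Data.Bool.Properties using (T-≡)
open import Data.Empty using (⊥-elim)
open import Data.Fin using (Fin; zero; suc; toℕ; fromℕ; fromℕ<; punchIn) renaming (_≟_ to _≟ᶠ_)
open import Data.Fin.Permutation using (Permutation; _⟨$⟩ʳ_; _⟨$⟩ˡ_; inverseˡ; inverseʳ)
import Data.Fin.Permutation as Perm
open import Data.Fin.Properties using (any?; toℕ-fromℕ<; toℕ-fromℕ; toℕ<n; toℕ-injective)
open import Data.Fin.Subset
open import Data.Fin.Subset.Induction using (⊂-wellFounded; Acc; acc)
open import Data.Fin.Subset.Properties
open import Data.List using (List; []; _∷_)
open import Data.Nat using (ℕ; zero; suc; _+_; _∸_; _≤_; _<_; z≤n; s≤s; _≤?_; _<?_; _≤ᵇ_; _<ᵇ_)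
open import Data.Nat.Properties
open import Algebra.Properties.CommutativeMonoid.Sum +-0-commutativeMonoid using (sum; sum-permute; sum-cong-≗)
open import Algebra.Properties.CommutativeSemigroup +-commutativeSemigroup using () renaming (interchange to +-interchange)
open import Data.Product using (Σ; _×_; _,_; ∃; proj₁; proj₂)
open import Data.Sum using (_⊎_; inj₁; inj₂; map₂)
open import Data.Unit using (tt) renaming (⊤ to Unit)
open import Data.Vec using (Vec; []; _∷_; lookup; tabulate; map; count; here; there)
open import Data.Vec.Properties
  using (lookup-replicate; lookup∘tabulate; tabulate∘lookup; tabulate-cong; lookup-zipWith; lookup-map; []=⇒lookup; lookup⇒[]=)
open import Function using (_∘_; case_of_)
open import Function.Bundles using (Equivalence)
open import Relation.Binary.PropositionalEquality
open import Relation.Nullary using (¬_; yes; no)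
open import Relation.Nullary.Decidable using (_×-dec_; ¬?)

open import Defs

-- Subsets of Fin n

private variable
  n : ℕ
  x y : Fin n
  p q : Subset n

∈⇒lookup : x ∈ p → lookup p x ≡ true
∈⇒lookup = []=⇒lookup

lookup⇒∈ : lookup p x ≡ true → x ∈ p
lookup⇒∈ {p = p} {x = x} = lookup⇒[]= x p

∉⇒lookup : x ∉ p → lookup p x ≡ false
∉⇒lookup {x = x} {p = p} x∉p with lookup p x in eq
... | true  = ⊥-elim (x∉p (lookup⇒∈ eq))
... | false = refl

subset-ext : (∀ x → lookup p x ≡ lookup q x) → p ≡ q
subset-ext {p = p} {q = q} h = trans (sym (tabulate∘lookup p)) (trans (tabulate-cong h) (tabulate∘lookup q))

lookup-∪ : ∀ (p q : Subset n) x → lookup (p ∪ q) x ≡ lookup p x ∨ lookup q x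
lookup-∪ p q x = lookup-zipWith _∨_ x p q

lookup-∩ : ∀ (p q : Subset n) x → lookup (p ∩ q) x ≡ lookup p x ∧ lookup q x
lookup-∩ p q x = lookup-zipWith _∧_ x p q

lookup-─ : ∀ (p q : Subset n) x → lookup (p ─ q) x ≡ lookup p x ∧ not (lookup q x)
lookup-─ (a ∷ p) (true  ∷ q) zero    with a
... | true  = refl
... | false = refl
lookup-─ (a ∷ p) (false ∷ q) zero    with a
... | true  = refl
... | false = refl
lookup-─ (a ∷ p) (b     ∷ q) (suc x) = lookup-─ p q x

lookup-∁ : ∀ (p : Subset n) x → lookup (∁ p) x ≡ not (lookup p x)
lookup-∁ p x = lookup-map x not p

∣p∪q∣+∣p∩q∣≡∣p∣+∣q∣ : ∀ (p q : Subset n) → ∣ p ∪ q ∣ + ∣ p ∩ q ∣ ≡ ∣ p ∣ + ∣ q ∣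
∣p∪q∣+∣p∩q∣≡∣p∣+∣q∣ []          []          = refl
∣p∪q∣+∣p∩q∣≡∣p∣+∣q∣ (true  ∷ p) (true  ∷ q) =
  cong suc (trans (+-suc ∣ p ∪ q ∣ ∣ p ∩ q ∣) (trans (cong suc (∣p∪q∣+∣p∩q∣≡∣p∣+∣q∣ p q)) (sym (+-suc ∣ p ∣ ∣ q ∣))))
∣p∪q∣+∣p∩q∣≡∣p∣+∣q∣ (true  ∷ p) (false ∷ q) = cong suc (∣p∪q∣+∣p∩q∣≡∣p∣+∣q∣ p q)
∣p∪q∣+∣p∩q∣≡∣p∣+∣q∣ (false ∷ p) (true  ∷ q) = trans (cong suc (∣p∪q∣+∣p∩q∣≡∣p∣+∣q∣ p q)) (sym (+-suc ∣ p ∣ ∣ q ∣))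
∣p∪q∣+∣p∩q∣≡∣p∣+∣q∣ (false ∷ p) (false ∷ q) = ∣p∪q∣+∣p∩q∣≡∣p∣+∣q∣ p q

∣p∣≡∣p∩q∣+∣p─q∣ : ∀ (p q : Subset n) → ∣ p ∣ ≡ ∣ p ∩ q ∣ + ∣ p ─ q ∣
∣p∣≡∣p∩q∣+∣p─q∣ []          []          = refl
∣p∣≡∣p∩q∣+∣p─q∣ (true  ∷ p) (true  ∷ q) = cong suc (∣p∣≡∣p∩q∣+∣p─q∣ p q)
∣p∣≡∣p∩q∣+∣p─q∣ (true  ∷ p) (false ∷ q) = trans (cong suc (∣p∣≡∣p∩q∣+∣p─q∣ p q)) (sym (+-suc ∣ p ∩ q ∣ ∣ p ─ q ∣))
∣p∣≡∣p∩q∣+∣p─q∣ (false ∷ p) (true  ∷ q) = ∣p∣≡∣p∩q∣+∣p─q∣ p q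
∣p∣≡∣p∩q∣+∣p─q∣ (false ∷ p) (false ∷ q) = ∣p∣≡∣p∩q∣+∣p─q∣ p q

x∉p⇒∣p∪⁅x⁆∣≡1+∣p∣ : ∀ {n} {x : Fin n} {p} → x ∉ p → ∣ p ∪ ⁅ x ⁆ ∣ ≡ suc ∣ p ∣
x∉p⇒∣p∪⁅x⁆∣≡1+∣p∣ {n = n} {x = x} {p = p} x∉p = begin
  ∣ p ∪ ⁅ x ⁆ ∣                 ≡⟨ +-identityʳ _ ⟨
  ∣ p ∪ ⁅ x ⁆ ∣ + 0             ≡⟨ cong (∣ p ∪ ⁅ x ⁆ ∣ +_) (trans (cong ∣_∣ p∩⁅x⁆≡⊥) (∣⊥∣≡0 n)) ⟨
  ∣ p ∪ ⁅ x ⁆ ∣ + ∣ p ∩ ⁅ x ⁆ ∣ ≡⟨ ∣p∪q∣+∣p∩q∣≡∣p∣+∣q∣ p ⁅ x ⁆ ⟩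
  ∣ p ∣ + ∣ ⁅ x ⁆ ∣             ≡⟨ cong (∣ p ∣ +_) (∣⁅x⁆∣≡1 x) ⟩
  ∣ p ∣ + 1                     ≡⟨ +-comm ∣ p ∣ 1 ⟩
  suc ∣ p ∣                     ∎
  where
  open ≡-Reasoning
  p∩⁅x⁆≡⊥ : p ∩ ⁅ x ⁆ ≡ ⊥
  p∩⁅x⁆≡⊥ = Empty-unique λ (y , y∈) → let (y∈p , y∈⁅x⁆) = x∈p∩q⁻ p ⁅ x ⁆ y∈ in
                                        x∉p (subst (_∈ p) (x∈⁅y⁆⇒x≡y x y∈⁅x⁆) y∈p)

x∈p⇒∣p∣≡1+∣p-x∣ : x ∈ p → ∣ p ∣ ≡ suc ∣ p - x ∣
x∈p⇒∣p∣≡1+∣p-x∣ {x = x} {p = p} x∈p =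
  trans (∣p∣≡∣p∩q∣+∣p─q∣ p ⁅ x ⁆) (cong (_+ ∣ p - x ∣) (trans (cong ∣_∣ p∩⁅x⁆≡⁅x⁆) (∣⁅x⁆∣≡1 x)))
  where
  p∩⁅x⁆≡⁅x⁆ : p ∩ ⁅ x ⁆ ≡ ⁅ x ⁆
  p∩⁅x⁆≡⁅x⁆ = ⊆-antisym (p∩q⊆q p ⁅ x ⁆)
    λ y∈⁅x⁆ → x∈p∩q⁺ (subst (_∈ p) (sym (x∈⁅y⁆⇒x≡y x y∈⁅x⁆)) x∈p , y∈⁅x⁆)

x∈p─q⇒x∉q : ∀ (p q : Subset n) → x ∈ p ─ q → x ∉ q
x∈p─q⇒x∉q (_ ∷ p) (true ∷ q) ()         here
x∈p─q⇒x∉q (_ ∷ p) (_    ∷ q) (there x∈) (there x∈q) = x∈p─q⇒x∉q p q x∈ x∈q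

x∉p-x : ∀ (p : Subset n) x → x ∉ p - x
x∉p-x p x x∈ = x∈p─q⇒x∉q p ⁅ x ⁆ x∈ (x∈⁅x⁆ x)

p-x∪⁅x⁆≡p : x ∈ p → (p - x) ∪ ⁅ x ⁆ ≡ p
p-x∪⁅x⁆≡p {x = x} {p = p} x∈p = ⊆-antisym to from
  where
  to : (p - x) ∪ ⁅ x ⁆ ⊆ p
  to y∈ with x∈p∪q⁻ (p - x) ⁅ x ⁆ y∈
  ... | inj₁ y∈p-x  = p─q⊆p p ⁅ x ⁆ y∈p-x
  ... | inj₂ y∈⁅x⁆  = subst (_∈ p) (sym (x∈⁅y⁆⇒x≡y x y∈⁅x⁆)) x∈p
  from : p ⊆ (p - x) ∪ ⁅ x ⁆
  from {y} y∈p with y ≟ᶠ x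
  ... | yes refl = q⊆p∪q (p - x) ⁅ x ⁆ (x∈⁅x⁆ x)
  ... | no  y≢x  = p⊆p∪q ⁅ x ⁆ (x∈p∧x≢y⇒x∈p-y y∈p y≢x)

⊆∧∣q∣≤∣p∣⇒p≡q : p ⊆ q → ∣ q ∣ ≤ ∣ p ∣ → p ≡ q
⊆∧∣q∣≤∣p∣⇒p≡q {p = p} {q = q} p⊆q ∣q∣≤∣p∣ = ⊆-antisym p⊆q q⊆p
  where
  q⊆p : q ⊆ p
  q⊆p {y} y∈q with y ∈? p
  ... | yes y∈p = y∈p
  ... | no  y∉p = ⊥-elim (<⇒≱ (p⊂q⇒∣p∣<∣q∣ (p⊆q , y , y∈q , y∉p)) ∣q∣≤∣p∣)

subset-induction : (P : Subset n → Set) → P ⊥ → (∀ Y y → y ∉ Y → P Y → P (Y ∪ ⁅ y ⁆)) → ∀ Y → P Y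
subset-induction P base step Y = go Y (⊂-wellFounded Y)
  where
  go : ∀ Y → Acc _⊂_ Y → P Y
  go Y (acc rec) with nonempty? Y
  ... | no  empty        = subst P (sym (Empty-unique empty)) base
  ... | yes (y , y∈Y)    =
    subst P (p-x∪⁅x⁆≡p y∈Y) (step (Y - y) y (x∉p-x Y y) (go (Y - y) (rec (x∈p⇒p-x⊂p y∈Y))))

module SetSolver where

  infixr 7 _∩ₑ_
  infixr 6 _∪ₑ_
  infixl 5 _─ₑ_

  data Expr (k : ℕ) : Set where
    var              : Fin k → Expr k
    _∪ₑ_ _∩ₑ_ _─ₑ_   : Expr k → Expr k → Expr k
    ∁ₑ               : Expr k → Expr k
    ⊤ₑ ⊥ₑ            : Expr k

  ⟦_⟧ : ∀ {k} → Expr k → Vec (Subset n) k → Subset n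
  ⟦ var i  ⟧ ρ = lookup ρ i
  ⟦ a ∪ₑ b ⟧ ρ = ⟦ a ⟧ ρ ∪ ⟦ b ⟧ ρ
  ⟦ a ∩ₑ b ⟧ ρ = ⟦ a ⟧ ρ ∩ ⟦ b ⟧ ρ
  ⟦ a ─ₑ b ⟧ ρ = ⟦ a ⟧ ρ ─ ⟦ b ⟧ ρ
  ⟦ ∁ₑ a   ⟧ ρ = ∁ (⟦ a ⟧ ρ)
  ⟦ ⊤ₑ     ⟧ ρ = ⊤
  ⟦ ⊥ₑ     ⟧ ρ = ⊥

  evalBool : ∀ {k} → Expr k → Vec Bool k → Bool
  evalBool (var i)  bs = lookup bs i
  evalBool (a ∪ₑ b) bs = evalBool a bs ∨ evalBool b bs
  evalBool (a ∩ₑ b) bs = evalBool a bs ∧ evalBool b bs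
  evalBool (a ─ₑ b) bs = evalBool a bs ∧ not (evalBool b bs)
  evalBool (∁ₑ a)   bs = not (evalBool a bs)
  evalBool ⊤ₑ       bs = true
  evalBool ⊥ₑ       bs = false

  column : ∀ {k} → Vec (Subset n) k → Fin n → Vec Bool k
  column ρ x = map (λ S → lookup S x) ρ

  lookup-⟦⟧ : ∀ {k} (e : Expr k) (ρ : Vec (Subset n) k) x → lookup (⟦ e ⟧ ρ) x ≡ evalBool e (column ρ x)
  lookup-⟦⟧ (var i)  ρ x = sym (lookup-map i (λ S → lookup S x) ρ)
  lookup-⟦⟧ (a ∪ₑ b) ρ x = trans (lookup-∪ (⟦ a ⟧ ρ) (⟦ b ⟧ ρ) x) (cong₂ _∨_ (lookup-⟦⟧ a ρ x) (lookup-⟦⟧ b ρ x))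
  lookup-⟦⟧ (a ∩ₑ b) ρ x = trans (lookup-∩ (⟦ a ⟧ ρ) (⟦ b ⟧ ρ) x) (cong₂ _∧_ (lookup-⟦⟧ a ρ x) (lookup-⟦⟧ b ρ x))
  lookup-⟦⟧ (a ─ₑ b) ρ x = trans (lookup-─ (⟦ a ⟧ ρ) (⟦ b ⟧ ρ) x) (cong₂ (λ u v → u ∧ not v) (lookup-⟦⟧ a ρ x) (lookup-⟦⟧ b ρ x))
  lookup-⟦⟧ (∁ₑ a)   ρ x = trans (lookup-∁ (⟦ a ⟧ ρ) x) (cong not (lookup-⟦⟧ a ρ x))
  lookup-⟦⟧ ⊤ₑ       ρ x = lookup-replicate x true
  lookup-⟦⟧ ⊥ₑ       ρ x = lookup-replicate x false

  forAll : ∀ k → (Vec Bool k → Bool) → Bool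
  forAll zero    f = f []
  forAll (suc k) f = forAll k (λ bs → f (true ∷ bs)) ∧ forAll k (λ bs → f (false ∷ bs))

  forAll-sound : ∀ k f → forAll k f ≡ true → ∀ bs → f bs ≡ true
  forAll-sound zero    f holds []           = holds
  forAll-sound (suc k) f holds (true ∷ bs)  with forAll k (λ bs → f (true ∷ bs)) in eq
  ... | true  = forAll-sound k _ eq bs
  forAll-sound (suc k) f holds (false ∷ bs) with forAll k (λ bs → f (true ∷ bs))
  ... | true  = forAll-sound k _ holds bs

  Inclusions : ℕ → Set
  Inclusions k = List (Expr k × Expr k)

  Holds : ∀ {k} → Inclusions k → Vec (Subset n) k → Set
  Holds []             ρ = Unit
  Holds ((a , b) ∷ hs) ρ = ⟦ a ⟧ ρ ⊆ ⟦ b ⟧ ρ × Holds hs ρ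

  holdsBool : ∀ {k} → Inclusions k → Vec Bool k → Bool
  holdsBool []             bs = true
  holdsBool ((a , b) ∷ hs) bs = (not (evalBool a bs) ∨ evalBool b bs) ∧ holdsBool hs bs

  entails : ∀ {k} → Inclusions k → Expr k → Expr k → Vec Bool k → Bool
  entails hs a b bs = not (holdsBool hs bs ∧ evalBool a bs) ∨ evalBool b bs

  Holds⇒holdsBool : ∀ {k} (hs : Inclusions k) (ρ : Vec (Subset n) k) x → Holds hs ρ → holdsBool hs (column ρ x) ≡ true
  Holds⇒holdsBool []             ρ x _         = refl
  Holds⇒holdsBool ((a , b) ∷ hs) ρ x (a⊆b , h) with evalBool a (column ρ x) in ea
  ... | false = Holds⇒holdsBool hs ρ x h
  ... | true  rewrite sym (lookup-⟦⟧ b ρ x) | ∈⇒lookup (a⊆b (lookup⇒∈ (trans (lookup-⟦⟧ a ρ x) ea))) =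
    Holds⇒holdsBool hs ρ x h

  -- Decided by running through all 2^k truth assignments, so a valid inclusion is certified by `refl`.
  ⊆-solve : ∀ {k} (hs : Inclusions k) (a b : Expr k) (ρ : Vec (Subset n) k) →
            forAll k (entails hs a b) ≡ true → Holds hs ρ → ⟦ a ⟧ ρ ⊆ ⟦ b ⟧ ρ
  ⊆-solve {k = k} hs a b ρ valid h {x} x∈a =
    lookup⇒∈ (trans (lookup-⟦⟧ b ρ x) (pointwise (trans (sym (lookup-⟦⟧ a ρ x)) (∈⇒lookup x∈a))))
    where
    pointwise : evalBool a (column ρ x) ≡ true → evalBool b (column ρ x) ≡ true
    pointwise ea with forAll-sound k (entails hs a b) valid (column ρ x)
    ... | r rewrite Holds⇒holdsBool hs ρ x h | ea = r

  ≡-solve : ∀ {k} (hs : Inclusions k) (a b : Expr k) (ρ : Vec (Subset n) k) →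
            forAll k (entails hs a b) ≡ true → forAll k (entails hs b a) ≡ true → Holds hs ρ → ⟦ a ⟧ ρ ≡ ⟦ b ⟧ ρ
  ≡-solve hs a b ρ valid valid′ h = ⊆-antisym (⊆-solve hs a b ρ valid h) (⊆-solve hs b a ρ valid′ h)

  v₀ : ∀ {k} → Expr (suc k)
  v₀ = var zero
  v₁ : ∀ {k} → Expr (2 + k)
  v₁ = var (suc zero)
  v₂ : ∀ {k} → Expr (3 + k)
  v₂ = var (suc (suc zero))
  v₃ : ∀ {k} → Expr (4 + k)
  v₃ = var (suc (suc (suc zero)))

open SetSolver using (_∪ₑ_; _∩ₑ_; _─ₑ_; ∁ₑ; ⊤ₑ; ⊥ₑ; ⊆-solve; ≡-solve; v₀; v₁; v₂; v₃)

x∈p⇒⁅x⁆⊆p : x ∈ p → ⁅ x ⁆ ⊆ p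
x∈p⇒⁅x⁆⊆p {p = p} x∈p y∈⁅x⁆ = subst (_∈ p) (sym (x∈⁅y⁆⇒x≡y _ y∈⁅x⁆)) x∈p

x∉p⇒⁅x⁆⊆∁p : x ∉ p → ⁅ x ⁆ ⊆ ∁ p
x∉p⇒⁅x⁆⊆∁p {p = p} x∉p y∈⁅x⁆ = x∉p⇒x∈∁p (subst (_∉ p) (sym (x∈⁅y⁆⇒x≡y _ y∈⁅x⁆)) x∉p)

x≢y⇒⁅x⁆⊆∁⁅y⁆ : ¬ x ≡ y → ⁅ x ⁆ ⊆ ∁ ⁅ y ⁆
x≢y⇒⁅x⁆⊆∁⁅y⁆ x≢y = x∉p⇒⁅x⁆⊆∁p (x≢y⇒x∉⁅y⁆ x≢y)

-- Rank functions

module RankFunction {n : ℕ} (M : Matroid n) where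

  private variable
    A B X Y : Subset n

  r : Subset n → ℕ
  r = rk M

  mono : X ⊆ Y → r X ≤ r Y
  mono {X} {Y} = rk-mono M X Y

  rk-⊥≡0 : r ⊥ ≡ 0
  rk-⊥≡0 = n≤0⇒n≡0 (subst (r ⊥ ≤_) (∣⊥∣≡0 n) (rk-card M ⊥))

  rk-⁅x⁆≤1 : ∀ x → r ⁅ x ⁆ ≤ 1
  rk-⁅x⁆≤1 x = subst (r ⁅ x ⁆ ≤_) (∣⁅x⁆∣≡1 x) (rk-card M ⁅ x ⁆)

  rk-∪≤ : ∀ X Y → r (X ∪ Y) ≤ r X + r Y
  rk-∪≤ X Y = ≤-trans (m≤m+n _ _) (rk-submod M X Y)

  rk⊤≤∣X∣+rk∁X : ∀ X → r ⊤ ≤ ∣ X ∣ + r (∁ X)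
  rk⊤≤∣X∣+rk∁X X = ≤-trans (mono (⊆-reflexive (sym (p∪∁p≡⊤ X)))) (≤-trans (rk-∪≤ X (∁ X)) (+-monoˡ-≤ _ (rk-card M X)))

  rk-∪⁅x⁆≤ : ∀ X x → r (X ∪ ⁅ x ⁆) ≤ suc (r X)
  rk-∪⁅x⁆≤ X x = ≤-trans (rk-∪≤ X ⁅ x ⁆) (subst (r X + r ⁅ x ⁆ ≤_) (+-comm (r X) 1) (+-monoʳ-≤ (r X) (rk-⁅x⁆≤1 x)))

  _∈cl_ : Fin n → Subset n → Set
  y ∈cl A = r (A ∪ ⁅ y ⁆) ≤ r A

  ∈⇒∈cl : y ∈ A → y ∈cl A
  ∈⇒∈cl {y} {A} y∈A = mono (⊆-solve ((v₁ , v₀) ∷ []) (v₀ ∪ₑ v₁) v₀ (A ∷ ⁅ y ⁆ ∷ []) refl (x∈p⇒⁅x⁆⊆p y∈A , tt))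

  ∈cl-mono : ∀ y → A ⊆ B → y ∈cl A → y ∈cl B
  ∈cl-mono {A} {B} y A⊆B y∈clA = +-cancelˡ-≤ (r A) _ _ (begin
    r A + r (B ∪ ⁅ y ⁆)                    ≡⟨ +-comm (r A) _ ⟩
    r (B ∪ ⁅ y ⁆) + r A                    ≤⟨ +-mono-≤ (mono B∪y⊆) (mono A⊆) ⟩
    r ((A ∪ ⁅ y ⁆) ∪ B) + r ((A ∪ ⁅ y ⁆) ∩ B) ≤⟨ rk-submod M _ _ ⟩
    r (A ∪ ⁅ y ⁆) + r B                    ≤⟨ +-monoˡ-≤ (r B) y∈clA ⟩
    r A + r B                              ∎)
    where
    open ≤-Reasoning
    ρ = A ∷ B ∷ ⁅ y ⁆ ∷ []
    B∪y⊆ : B ∪ ⁅ y ⁆ ⊆ (A ∪ ⁅ y ⁆) ∪ B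
    B∪y⊆ = ⊆-solve [] (v₁ ∪ₑ v₂) ((v₀ ∪ₑ v₂) ∪ₑ v₁) ρ refl tt
    A⊆ : A ⊆ (A ∪ ⁅ y ⁆) ∩ B
    A⊆ = ⊆-solve ((v₀ , v₁) ∷ []) v₀ ((v₀ ∪ₑ v₂) ∩ₑ v₁) ρ refl (A⊆B , tt)

  ⊆cl⇒rk-∪≤ : (∀ y → y ∈ Y → y ∈cl A) → r (A ∪ Y) ≤ r A
  ⊆cl⇒rk-∪≤ {Y} {A} = subset-induction P base step Y
    where
    P : Subset n → Set
    P Y = (∀ y → y ∈ Y → y ∈cl A) → r (A ∪ Y) ≤ r A
    base : P ⊥
    base _ = ≤-reflexive (cong r (∪-identityʳ A))
    step : ∀ Y y → y ∉ Y → P Y → P (Y ∪ ⁅ y ⁆)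
    step Y y _ ih Y∪y⊆cl = begin
      r (A ∪ (Y ∪ ⁅ y ⁆)) ≡⟨ cong r (sym (∪-assoc A Y ⁅ y ⁆)) ⟩
      r ((A ∪ Y) ∪ ⁅ y ⁆) ≤⟨ ∈cl-mono y (p⊆p∪q Y) (Y∪y⊆cl y (q⊆p∪q Y ⁅ y ⁆ (x∈⁅x⁆ y))) ⟩
      r (A ∪ Y)           ≤⟨ ih (λ z z∈Y → Y∪y⊆cl z (p⊆p∪q ⁅ y ⁆ z∈Y)) ⟩
      r A                 ∎
      where open ≤-Reasoning

  independent-⊆ : X ⊆ Y → r Y ≡ ∣ Y ∣ → r X ≡ ∣ X ∣
  independent-⊆ {X} {Y} X⊆Y rY≡∣Y∣ = ≤-antisym (rk-card M X) (+-cancelʳ-≤ ∣ Y ─ X ∣ _ _ (begin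
    ∣ X ∣ + ∣ Y ─ X ∣     ≡⟨ cong (λ Z → ∣ Z ∣ + ∣ Y ─ X ∣) Y∩X≡X ⟨
    ∣ Y ∩ X ∣ + ∣ Y ─ X ∣ ≡⟨ ∣p∣≡∣p∩q∣+∣p─q∣ Y X ⟨
    ∣ Y ∣                 ≡⟨ rY≡∣Y∣ ⟨
    r Y                   ≤⟨ mono (⊆-solve [] v₁ (v₀ ∪ₑ (v₁ ─ₑ v₀)) (X ∷ Y ∷ []) refl tt) ⟩
    r (X ∪ (Y ─ X))       ≤⟨ rk-∪≤ X (Y ─ X) ⟩
    r X + r (Y ─ X)       ≤⟨ +-monoʳ-≤ (r X) (rk-card M (Y ─ X)) ⟩
    r X + ∣ Y ─ X ∣       ∎))
    where
    open ≤-Reasoning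
    Y∩X≡X : Y ∩ X ≡ X
    Y∩X≡X = ⊆-antisym (p∩q⊆q Y X) (λ x∈X → x∈p∩q⁺ (X⊆Y x∈X , x∈X))

  -- r (D - t) < r D says that t is a coloop of the restriction to D.
  coloops⇒rk[D─Y]+∣Y∣≤rk[D] : ∀ D Y → (∀ t → t ∈ Y → r (D - t) < r D) → r (D ─ Y) + ∣ Y ∣ ≤ r D
  coloops⇒rk[D─Y]+∣Y∣≤rk[D] D = subset-induction P base step
    where
    P : Subset n → Set
    P Y = (∀ t → t ∈ Y → r (D - t) < r D) → r (D ─ Y) + ∣ Y ∣ ≤ r D
    base : P ⊥
    base _ = ≤-reflexive (trans (cong₂ _+_ (cong r (p─⊥≡p D)) (∣⊥∣≡0 n)) (+-identityʳ (r D)))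
    step : ∀ Y t → t ∉ Y → P Y → P (Y ∪ ⁅ t ⁆)
    step Y t t∉Y ih coloops = begin
      r (D ─ (Y ∪ ⁅ t ⁆)) + ∣ Y ∪ ⁅ t ⁆ ∣ ≡⟨ cong (r (D ─ (Y ∪ ⁅ t ⁆)) +_) (x∉p⇒∣p∪⁅x⁆∣≡1+∣p∣ t∉Y) ⟩
      r (D ─ (Y ∪ ⁅ t ⁆)) + suc ∣ Y ∣     ≡⟨ +-suc _ _ ⟩
      suc (r (D ─ (Y ∪ ⁅ t ⁆))) + ∣ Y ∣   ≤⟨ +-monoˡ-≤ ∣ Y ∣ drop ⟩
      r (D ─ Y) + ∣ Y ∣                   ≤⟨ ih (λ u u∈Y → coloops u (p⊆p∪q ⁅ t ⁆ u∈Y)) ⟩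
      r D                                 ∎
      where
      open ≤-Reasoning
      ρ = D ∷ Y ∷ ⁅ t ⁆ ∷ []
      submod : r D + r (D ─ (Y ∪ ⁅ t ⁆)) ≤ r (D - t) + r (D ─ Y)
      submod = ≤-trans
        (+-mono-≤ (mono (⊆-solve ((v₂ , ∁ₑ v₁) ∷ []) v₀ ((v₀ ─ₑ v₂) ∪ₑ (v₀ ─ₑ v₁)) ρ refl (x∉p⇒⁅x⁆⊆∁p t∉Y , tt)))
                  (mono (⊆-solve [] (v₀ ─ₑ (v₁ ∪ₑ v₂)) ((v₀ ─ₑ v₂) ∩ₑ (v₀ ─ₑ v₁)) ρ refl tt)))
        (rk-submod M (D - t) (D ─ Y))
      drop : suc (r (D ─ (Y ∪ ⁅ t ⁆))) ≤ r (D ─ Y)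
      drop = +-cancelˡ-≤ (r (D - t)) _ _ (begin
        r (D - t) + suc (r (D ─ (Y ∪ ⁅ t ⁆))) ≡⟨ +-suc _ _ ⟩
        suc (r (D - t)) + r (D ─ (Y ∪ ⁅ t ⁆)) ≤⟨ +-monoˡ-≤ _ (coloops t (q⊆p∪q Y ⁅ t ⁆ (x∈⁅x⁆ t))) ⟩
        r D + r (D ─ (Y ∪ ⁅ t ⁆))             ≤⟨ submod ⟩
        r (D - t) + r (D ─ Y)                 ∎)

  coloops⇒independent : ∀ D → (∀ t → t ∈ D → r (D - t) < r D) → r D ≡ ∣ D ∣
  coloops⇒independent D coloops =
    ≤-antisym (rk-card M D) (≤-trans (m≤n+m ∣ D ∣ (r (D ─ D))) (coloops⇒rk[D─Y]+∣Y∣≤rk[D] D D coloops))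

  rk≤⇒⊆cl : ∀ {B G} → B ⊆ G → r G ≤ r B → ∀ z → z ∈ G → z ∈cl B
  rk≤⇒⊆cl {B} {G} B⊆G rG≤rB z z∈G =
    ≤-trans (mono (⊆-solve ((v₀ , v₁) ∷ (v₂ , v₁) ∷ []) (v₀ ∪ₑ v₂) v₁ (B ∷ G ∷ ⁅ z ⁆ ∷ []) refl
                           (B⊆G , x∈p⇒⁅x⁆⊆p z∈G , tt)))
            rG≤rB

  ∃spanning-independent : ∀ G → ∃ λ B → B ⊆ G × r B ≡ ∣ B ∣ × r G ≤ r B
  ∃spanning-independent = subset-induction _ (⊥ , ⊆-refl , trans rk-⊥≡0 (sym (∣⊥∣≡0 n)) , ≤-refl) step
    where
    step : ∀ G y → y ∉ G → (∃ λ B → B ⊆ G × r B ≡ ∣ B ∣ × r G ≤ r B) →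
           ∃ λ B → B ⊆ G ∪ ⁅ y ⁆ × r B ≡ ∣ B ∣ × r (G ∪ ⁅ y ⁆) ≤ r B
    step G y y∉G (B , B⊆G , indB , rG≤rB) with suc (r B) ≤? r (B ∪ ⁅ y ⁆)
    ... | yes y∉clB = B ∪ ⁅ y ⁆ , B∪y⊆ , indB∪y , ≤-trans (mono (q⊆p∪q (B ∪ ⁅ y ⁆) _)) (⊆cl⇒rk-∪≤ G∪y⊆cl)
      where
      ρ = B ∷ G ∷ ⁅ y ⁆ ∷ []
      B∪y⊆ : B ∪ ⁅ y ⁆ ⊆ G ∪ ⁅ y ⁆
      B∪y⊆ = ⊆-solve ((v₀ , v₁) ∷ []) (v₀ ∪ₑ v₂) (v₁ ∪ₑ v₂) ρ refl (B⊆G , tt)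
      indB∪y : r (B ∪ ⁅ y ⁆) ≡ ∣ B ∪ ⁅ y ⁆ ∣
      indB∪y = trans (≤-antisym (rk-∪⁅x⁆≤ B y) y∉clB) (trans (cong suc indB) (sym (x∉p⇒∣p∪⁅x⁆∣≡1+∣p∣ (y∉G ∘ B⊆G))))
      G∪y⊆cl : ∀ z → z ∈ G ∪ ⁅ y ⁆ → z ∈cl (B ∪ ⁅ y ⁆)
      G∪y⊆cl z z∈ with x∈p∪q⁻ G ⁅ y ⁆ z∈
      ... | inj₁ z∈G = ∈cl-mono z (p⊆p∪q ⁅ y ⁆) (rk≤⇒⊆cl B⊆G rG≤rB z z∈G)
      ... | inj₂ z∈y = ∈⇒∈cl (q⊆p∪q B ⁅ y ⁆ z∈y)
    ... | no y∈clB = B , ⊆-trans B⊆G (p⊆p∪q ⁅ y ⁆) , indB , ≤-trans (mono (q⊆p∪q B _)) (⊆cl⇒rk-∪≤ G∪y⊆cl)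
      where
      G∪y⊆cl : ∀ z → z ∈ G ∪ ⁅ y ⁆ → z ∈cl B
      G∪y⊆cl z z∈ with x∈p∪q⁻ G ⁅ y ⁆ z∈
      ... | inj₁ z∈G = rk≤⇒⊆cl B⊆G rG≤rB z z∈G
      ... | inj₂ z∈y = subst (_∈cl B) (sym (x∈⁅y⁆⇒x≡y y z∈y)) (≤-pred (≰⇒> y∈clB))

  module Restriction (G : Subset n) where

    basis-spans : ∀ {B} → Basis ⟨ G , r ⟩ B → r G ≤ r B
    basis-spans {B} ((B⊆G , indB) , maximal) = ≤-trans (mono (q⊆p∪q B G)) (⊆cl⇒rk-∪≤ G⊆clB)
      where
      G⊆clB : ∀ y → y ∈ G → y ∈cl B
      G⊆clB y y∈G with suc (r B) ≤? r (B ∪ ⁅ y ⁆)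
      ... | no  y∈clB   = ≤-pred (≰⇒> y∈clB)
      ... | yes y∉clB   = ⊥-elim (<-irrefl (cong r (sym B∪y≡B)) y∉clB)
        where
        y∉B : y ∉ B
        y∉B y∈B = <⇒≱ y∉clB (∈⇒∈cl y∈B)
        B∪y≡B : B ∪ ⁅ y ⁆ ≡ B
        B∪y≡B = maximal (B ∪ ⁅ y ⁆)
          (⊆-solve ((v₀ , v₁) ∷ (v₂ , v₁) ∷ []) (v₀ ∪ₑ v₂) v₁ (B ∷ G ∷ ⁅ y ⁆ ∷ []) refl (B⊆G , x∈p⇒⁅x⁆⊆p y∈G , tt) ,
           trans (≤-antisym (rk-∪⁅x⁆≤ B y) y∉clB) (trans (cong suc indB) (sym (x∉p⇒∣p∪⁅x⁆∣≡1+∣p∣ y∉B))))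
          (p⊆p∪q ⁅ y ⁆)

    coloop⇒rk-drop : ∀ {f} → Coloop ⟨ G , r ⟩ f → r (G - f) < r G
    coloop⇒rk-drop {f} (f∈G , inEveryBasis) with r (G - f) <? r G
    ... | yes drop    = drop
    ... | no  no-drop with ∃spanning-independent (G - f)
    ... | B₀ , B⊆G-f , indB , spans = ⊥-elim (x∉p-x G f (B⊆G-f (inEveryBasis B₀ basis)))
      where
      basis : Basis ⟨ G , r ⟩ B₀
      basis = (⊆-trans B⊆G-f (p─q⊆p G ⁅ f ⁆) , indB) ,
              λ Y (Y⊆G , indY) B⊆Y → sym (⊆∧∣q∣≤∣p∣⇒p≡q B⊆Y (begin
                ∣ Y ∣     ≡⟨ indY ⟨
                r Y       ≤⟨ mono Y⊆G ⟩
                r G       ≤⟨ ≤-pred (≰⇒> no-drop) ⟩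
                r (G - f) ≤⟨ spans ⟩
                r B₀      ≡⟨ indB ⟩
                ∣ B₀ ∣    ∎))
        where open ≤-Reasoning

    rk-drop⇒coloop : ∀ {f} → f ∈ G → r (G - f) < r G → Coloop ⟨ G , r ⟩ f
    rk-drop⇒coloop {f} f∈G drop = f∈G , f∈basis
      where
      f∈basis : ∀ B → Basis ⟨ G , r ⟩ B → f ∈ B
      f∈basis B basis with f ∈? B
      ... | yes f∈B = f∈B
      ... | no  f∉B = ⊥-elim (<⇒≱ drop (≤-trans (basis-spans basis) (mono B⊆G-f)))
        where
        B⊆G-f : B ⊆ G - f
        B⊆G-f = ⊆-solve ((v₀ , v₁) ∷ (v₂ , ∁ₑ v₀) ∷ []) v₀ (v₁ ─ₑ v₂) (B ∷ G ∷ ⁅ f ⁆ ∷ []) refl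
                        (proj₁ (proj₁ basis) , x∉p⇒⁅x⁆⊆∁p f∉B , tt)

  circuit⇒rk[C]≤rk[C-e] : ∀ {C e} → Circuit (toData M) C → e ∈ C → r C ≤ r (C - e)
  circuit⇒rk[C]≤rk[C-e] {C} {e} ((_ , dependent) , minimal) e∈C =
    subst (r C ≤_) (sym (proj₂ (minimal (C - e) (x∈p⇒p-x⊂p e∈C))))
          (≤-pred (subst (r C <_) (x∈p⇒∣p∣≡1+∣p-x∣ e∈C) dependent))

  -- The last hypothesis says that e is no longer spanned once any other element is removed from C.
  minimal-spanning⇒circuit : ∀ {C e} → e ∈ C → r C ≤ r (C - e) →
    (∀ y → y ∈ C → ¬ y ≡ e → r (C - y - e) < r (C - y)) → Circuit (toData M) C
  minimal-spanning⇒circuit {C} {e} e∈C spans minimal = ((⊆⊤ , dependent) , proper⇒independent)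
    where
    dependent : r C < ∣ C ∣
    dependent = ≤-<-trans spans (subst (r (C - e) <_) (sym (x∈p⇒∣p∣≡1+∣p-x∣ e∈C)) (s≤s (rk-card M (C - e))))
    z∈C-e⇒z≢e : ∀ {z} → z ∈ C - e → ¬ z ≡ e
    z∈C-e⇒z≢e z∈ refl = x∉p-x C e z∈
    C-e-independent : r (C - e) ≡ ∣ C - e ∣
    C-e-independent = coloops⇒independent (C - e) λ z z∈C-e → begin-strict
      r (C - e - z) ≡⟨ cong r (p─x─y≡p─y─x C e z) ⟩
      r (C - z - e) <⟨ minimal z (p─q⊆p C ⁅ e ⁆ z∈C-e) (z∈C-e⇒z≢e z∈C-e) ⟩
      r (C - z)     ≤⟨ mono (p─q⊆p C ⁅ z ⁆) ⟩
      r C           ≤⟨ spans ⟩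
      r (C - e)     ∎
      where open ≤-Reasoning
    C-y-independent : ∀ y → y ∈ C → r (C - y) ≡ ∣ C - y ∣
    C-y-independent y y∈C with y ≟ᶠ e
    ... | yes refl = C-e-independent
    ... | no  y≢e  = ≤-antisym (rk-card M (C - y)) (begin
      ∣ C - y ∣         ≡⟨ x∈p⇒∣p∣≡1+∣p-x∣ e∈C-y ⟩
      suc ∣ C - y - e ∣ ≡⟨ cong suc C-y-e-independent ⟨
      suc (r (C - y - e)) ≤⟨ minimal y y∈C y≢e ⟩
      r (C - y)         ∎)
      where
      open ≤-Reasoning
      e∈C-y : e ∈ C - y
      e∈C-y = x∈p∧x≢y⇒x∈p-y e∈C (λ e≡y → y≢e (sym e≡y))
      C-y-e-independent : r (C - y - e) ≡ ∣ C - y - e ∣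
      C-y-e-independent = independent-⊆ (⊆-trans (⊆-reflexive (p─x─y≡p─y─x C y e)) (p─q⊆p (C - e) ⁅ y ⁆)) C-e-independent
    proper⇒independent : ∀ D → D ⊂ C → Independent (toData M) D
    proper⇒independent D (D⊆C , y , y∈C , y∉D) = ⊆⊤ , independent-⊆ D⊆C-y (C-y-independent y y∈C)
      where
      D⊆C-y : D ⊆ C - y
      D⊆C-y z∈D = x∈p∧x≢y⇒x∈p-y (D⊆C z∈D) (λ { refl → y∉D z∈D })

  spanning⇒∃circuit : ∀ F e → e ∈ F → r F ≤ r (F - e) → ∃ λ C → Circuit (toData M) C × e ∈ C × C ⊆ F
  spanning⇒∃circuit F e e∈F spans = shrink F (⊂-wellFounded F) e∈F ⊆-refl spans
    where
    shrink : ∀ C → Acc _⊂_ C → e ∈ C → C ⊆ F → r C ≤ r (C - e) → ∃ λ C → Circuit (toData M) C × e ∈ C × C ⊆ F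
    shrink C (acc smaller) e∈C C⊆F spansC
      with any? (λ y → (y ∈? C) ×-dec (¬? (y ≟ᶠ e)) ×-dec (r (C - y) ≤? r (C - y - e)))
    ... | yes (y , y∈C , y≢e , spansC-y) =
      shrink (C - y) (smaller (x∈p⇒p-x⊂p y∈C)) (x∈p∧x≢y⇒x∈p-y e∈C (λ e≡y → y≢e (sym e≡y)))
             (⊆-trans (p─q⊆p C ⁅ y ⁆) C⊆F) spansC-y
    ... | no  none = C , minimal-spanning⇒circuit e∈C spansC minimal , e∈C , C⊆F
      where
      minimal : ∀ y → y ∈ C → ¬ y ≡ e → r (C - y - e) < r (C - y)
      minimal y y∈C y≢e with r (C - y) ≤? r (C - y - e)
      ... | yes spansC-y = ⊥-elim (none (y , y∈C , y≢e , spansC-y))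
      ... | no  ¬spans   = ≰⇒> ¬spans

-- Flats, cyclic sets and parallel classes

∈tabulate⁺ : ∀ {f : Fin n → Bool} {y} → T (f y) → y ∈ tabulate f
∈tabulate⁺ {f = f} {y} fy = lookup⇒∈ (trans (lookup∘tabulate f y) (Equivalence.to T-≡ fy))

∈tabulate⁻ : ∀ {f : Fin n → Bool} {y} → y ∈ tabulate f → T (f y)
∈tabulate⁻ {f = f} {y} y∈ = Equivalence.from T-≡ (trans (sym (lookup∘tabulate f y)) (∈⇒lookup y∈))

module Flats {n : ℕ} (M : Matroid n) where

  open RankFunction M

  private variable
    X Y : Subset n

  IsFlat : Subset n → Set
  IsFlat F = ∀ e → e ∉ F → r F < r (F ∪ ⁅ e ⁆)

  IsCyclic : Subset n → Set
  IsCyclic F = ∀ e → e ∈ F → r F ≤ r (F - e)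

  IsSplit : Set
  IsSplit = ∀ F₁ F₂ → IsFlat F₁ → IsCyclic F₁ → IsFlat F₂ → IsCyclic F₂ → F₁ ⊂ F₂ → F₁ ≡ ⊥ ⊎ F₂ ≡ ⊤

  split⇒IsSplit : SplitCond (toData M) → IsSplit
  split⇒IsSplit split F₁ F₂ flat₁ cyc₁ flat₂ cyc₂ = split F₁ F₂ (cyclicFlat flat₁ cyc₁) (cyclicFlat flat₂ cyc₂)
    where
    cyclicFlat : ∀ {F} → IsFlat F → IsCyclic F → CyclicFlat (toData M) F
    cyclicFlat {F} flat cyc = (⊆⊤ , λ e _ e∉F → flat e e∉F) , (⊆⊤ , λ e e∈F → spanning⇒∃circuit F e e∈F (cyc e e∈F))

  spanned-by-rest-⊆ : ∀ {y} → y ∈ X → r X ≤ r (X - y) → X ⊆ Y → r Y ≤ r (Y - y)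
  spanned-by-rest-⊆ {X} {Y} {y} y∈X spansX X⊆Y =
    ≤-trans (mono (⊆-solve [] v₁ ((v₁ ─ₑ v₂) ∪ₑ v₂) ρ refl tt))
            (∈cl-mono y (⊆-solve ((v₀ , v₁) ∷ []) (v₀ ─ₑ v₂) (v₁ ─ₑ v₂) ρ refl (X⊆Y , tt))
                      (≤-trans (mono (⊆-solve ((v₂ , v₀) ∷ []) ((v₀ ─ₑ v₂) ∪ₑ v₂) v₀ ρ refl (x∈p⇒⁅x⁆⊆p y∈X , tt)))
                               spansX))
    where ρ = X ∷ Y ∷ ⁅ y ⁆ ∷ []

  ∪-cyclic : IsCyclic X → IsCyclic Y → IsCyclic (X ∪ Y)
  ∪-cyclic {X} {Y} cycX cycY y y∈X∪Y with x∈p∪q⁻ X Y y∈X∪Y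
  ... | inj₁ y∈X = spanned-by-rest-⊆ y∈X (cycX y y∈X) (p⊆p∪q Y)
  ... | inj₂ y∈Y = spanned-by-rest-⊆ y∈Y (cycY y y∈Y) (q⊆p∪q X Y)

  closure : Subset n → Subset n
  closure A = tabulate (λ y → r (A ∪ ⁅ y ⁆) ≤ᵇ r A)

  ∈closure⁺ : ∀ {A y} → y ∈cl A → y ∈ closure A
  ∈closure⁺ y∈clA = ∈tabulate⁺ (≤⇒≤ᵇ y∈clA)

  ∈closure⁻ : ∀ {A y} → y ∈ closure A → y ∈cl A
  ∈closure⁻ {A} {y} y∈ = ≤ᵇ⇒≤ (r (A ∪ ⁅ y ⁆)) (r A) (∈tabulate⁻ y∈)

  ⊆closure : ∀ A → A ⊆ closure A
  ⊆closure A y∈A = ∈closure⁺ (∈⇒∈cl y∈A)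

  rk-closure≤ : ∀ A → r (closure A) ≤ r A
  rk-closure≤ A = ≤-trans (mono (q⊆p∪q A (closure A))) (⊆cl⇒rk-∪≤ (λ y → ∈closure⁻))

  closure-flat : ∀ A → IsFlat (closure A)
  closure-flat A y y∉cl = begin-strict
    r (closure A)          ≤⟨ rk-closure≤ A ⟩
    r A                    <⟨ ≰⇒> (y∉cl ∘ ∈closure⁺) ⟩
    r (A ∪ ⁅ y ⁆)           ≤⟨ mono (⊆-solve ((v₀ , v₁) ∷ []) (v₀ ∪ₑ v₂) (v₁ ∪ₑ v₂) (A ∷ closure A ∷ ⁅ y ⁆ ∷ []) refl (⊆closure A , tt)) ⟩
    r (closure A ∪ ⁅ y ⁆)   ∎
    where open ≤-Reasoning

  closure-cyclic : ∀ A → IsCyclic A → IsCyclic (closure A)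
  closure-cyclic A cycA y y∈cl with y ∈? A
  ... | yes y∈A = spanned-by-rest-⊆ y∈A (cycA y y∈A) (⊆closure A)
  ... | no  y∉A = ≤-trans (rk-closure≤ A)
                    (mono (⊆-solve ((v₀ , v₁) ∷ (v₂ , ∁ₑ v₀) ∷ []) v₀ (v₁ ─ₑ v₂) (A ∷ closure A ∷ ⁅ y ⁆ ∷ [])
                                   refl (⊆closure A , x∉p⇒⁅x⁆⊆∁p y∉A , tt)))

  Parallel : Fin n → Fin n → Set
  Parallel e f = ¬ f ≡ e × r (⁅ e ⁆ ∪ ⁅ f ⁆) ≤ 1

  parallelClass : Fin n → Subset n
  parallelClass e = tabulate (λ y → r (⁅ e ⁆ ∪ ⁅ y ⁆) ≤ᵇ 1)

  ∈parallelClass⁺ : ∀ {e y} → r (⁅ e ⁆ ∪ ⁅ y ⁆) ≤ 1 → y ∈ parallelClass e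
  ∈parallelClass⁺ le = ∈tabulate⁺ (≤⇒≤ᵇ le)

  ∈parallelClass⁻ : ∀ {e y} → y ∈ parallelClass e → r (⁅ e ⁆ ∪ ⁅ y ⁆) ≤ 1
  ∈parallelClass⁻ {e} {y} y∈ = ≤ᵇ⇒≤ (r (⁅ e ⁆ ∪ ⁅ y ⁆)) 1 (∈tabulate⁻ y∈)

  e∈parallelClass : ∀ e → e ∈ parallelClass e
  e∈parallelClass e = ∈parallelClass⁺ (subst (λ Z → r Z ≤ 1) (sym (∪-idem ⁅ e ⁆)) (rk-⁅x⁆≤1 e))

  module Loopless (loopless : ∀ e → r ⁅ e ⁆ ≡ 1) where

    rk-parallelClass≤1 : ∀ e → r (parallelClass e) ≤ 1
    rk-parallelClass≤1 e = begin
      r (parallelClass e)           ≤⟨ mono (q⊆p∪q ⁅ e ⁆ _) ⟩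
      r (⁅ e ⁆ ∪ parallelClass e)   ≤⟨ ⊆cl⇒rk-∪≤ (λ y y∈ → subst (r (⁅ e ⁆ ∪ ⁅ y ⁆) ≤_) (sym (loopless e)) (∈parallelClass⁻ y∈)) ⟩
      r ⁅ e ⁆                       ≤⟨ rk-⁅x⁆≤1 e ⟩
      1                             ∎
      where open ≤-Reasoning

    parallelClass-flat : ∀ e → IsFlat (parallelClass e)
    parallelClass-flat e y y∉ = begin-strict
      r (parallelClass e)          ≤⟨ rk-parallelClass≤1 e ⟩
      1                            <⟨ ≰⇒> (y∉ ∘ ∈parallelClass⁺) ⟩
      r (⁅ e ⁆ ∪ ⁅ y ⁆)             ≤⟨ mono (⊆-solve ((v₀ , v₁) ∷ []) (v₀ ∪ₑ v₂) (v₁ ∪ₑ v₂)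
                                                     (⁅ e ⁆ ∷ parallelClass e ∷ ⁅ y ⁆ ∷ []) refl (x∈p⇒⁅x⁆⊆p (e∈parallelClass e) , tt)) ⟩
      r (parallelClass e ∪ ⁅ y ⁆)   ∎
      where open ≤-Reasoning

    ∃parallel-avoiding : ∀ {e e'} → Parallel e e' → ∀ y → ∃ λ z → z ∈ parallelClass e × ¬ z ≡ y
    ∃parallel-avoiding {e} {e'} (e'≢e , rk≤1) y with y ≟ᶠ e
    ... | yes refl = e' , ∈parallelClass⁺ rk≤1 , e'≢e
    ... | no  y≢e  = e , e∈parallelClass e , λ e≡y → y≢e (sym e≡y)

    parallelClass-cyclic : ∀ {e e'} → Parallel e e' → IsCyclic (parallelClass e)
    parallelClass-cyclic {e} par y y∈ with ∃parallel-avoiding par y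
    ... | z , z∈ , z≢y = ≤-trans (rk-parallelClass≤1 e) (subst (_≤ r (parallelClass e - y)) (loopless z)
            (mono (⊆-solve ((v₂ , v₀) ∷ (v₂ , ∁ₑ v₁) ∷ []) v₂ (v₀ ─ₑ v₁) (parallelClass e ∷ ⁅ y ⁆ ∷ ⁅ z ⁆ ∷ [])
                           refl (x∈p⇒⁅x⁆⊆p z∈ , x≢y⇒⁅x⁆⊆∁⁅y⁆ z≢y , tt))))

    -- Two distinct non-trivial parallel classes are proper cyclic flats, and so is the closure of their
    -- union, which strictly contains the first; splitness forces that closure to be everything.
    two-parallel-classes⇒rank≤2 : IsSplit → ∀ {e e' x x'} → Parallel e e' → Parallel x x' →
                                  ¬ r (⁅ e ⁆ ∪ ⁅ x ⁆) ≤ 1 → r ⊤ ≤ 2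
    two-parallel-classes⇒rank≤2 split {e} {e'} {x} parE parX e∦x
      with split P F (parallelClass-flat e) (parallelClass-cyclic parE)
                 (closure-flat (P ∪ Q)) (closure-cyclic (P ∪ Q) (∪-cyclic (parallelClass-cyclic parE) (parallelClass-cyclic parX)))
                 (⊆-trans (p⊆p∪q Q) (⊆closure (P ∪ Q)) , x , ⊆closure (P ∪ Q) (q⊆p∪q P Q (e∈parallelClass x)) , e∦x ∘ ∈parallelClass⁻)
      where
      P = parallelClass e
      Q = parallelClass x
      F = closure (P ∪ Q)
    ... | inj₁ P≡⊥ = ⊥-elim (∉⊥ (subst (e ∈_) P≡⊥ (e∈parallelClass e)))
    ... | inj₂ F≡⊤ = begin
      r ⊤                                             ≡⟨ cong r F≡⊤ ⟨
      r (closure (parallelClass e ∪ parallelClass x)) ≤⟨ rk-closure≤ _ ⟩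
      r (parallelClass e ∪ parallelClass x)           ≤⟨ rk-∪≤ _ _ ⟩
      r (parallelClass e) + r (parallelClass x)       ≤⟨ +-mono-≤ (rk-parallelClass≤1 e) (rk-parallelClass≤1 x) ⟩
      2                                               ∎
      where open ≤-Reasoning

    everywhere-parallel⇒rank≤2 : IsSplit → (∀ e → ∃ (Parallel e)) → r ⊤ ≤ 2
    everywhere-parallel⇒rank≤2 split parallel with nonempty? (⊤ {n})
    ... | no  empty   = subst (_≤ 2) (cong r (sym (Empty-unique empty))) (subst (_≤ 2) (sym rk-⊥≡0) z≤n)
    ... | yes (e , _) with any? (λ x → ¬? (r (⁅ e ⁆ ∪ ⁅ x ⁆) ≤? 1))
    ...   | yes (x , e∦x) = two-parallel-classes⇒rank≤2 split (proj₂ (parallel e)) (proj₂ (parallel x)) e∦x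
    ...   | no  none      = ≤-trans (mono ⊤⊆P) (≤-trans (rk-parallelClass≤1 e) (s≤s z≤n))
      where
      ⊤⊆P : ⊤ ⊆ parallelClass e
      ⊤⊆P {y} _ with r (⁅ e ⁆ ∪ ⁅ y ⁆) ≤? 1
      ... | yes e∥y = ∈parallelClass⁺ e∥y
      ... | no  e∦y = ⊥-elim (none (y , e∦y))

-- Minors and duals

∸-preserves-+≤ : ∀ c a₁ a₂ b₁ b₂ → c ≤ a₁ → c ≤ a₂ → c ≤ b₁ → c ≤ b₂ →
                 a₁ + a₂ ≤ b₁ + b₂ → (a₁ ∸ c) + (a₂ ∸ c) ≤ (b₁ ∸ c) + (b₂ ∸ c)
∸-preserves-+≤ zero    a₁       a₂       b₁       b₂       _       _       _       _       le = le
∸-preserves-+≤ (suc c) (suc a₁) (suc a₂) (suc b₁) (suc b₂) (s≤s p) (s≤s q) (s≤s u) (s≤s v) le =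
  ∸-preserves-+≤ c a₁ a₂ b₁ b₂ p q u v (≤-pred (subst₂ _≤_ (+-suc a₁ a₂) (+-suc b₁ b₂) (≤-pred le)))

∸-reflects-≤ : ∀ {a b} c → c ≤ a → c ≤ b → a ∸ c ≤ b ∸ c → a ≤ b
∸-reflects-≤ c c≤a c≤b le = subst₂ _≤_ (m∸n+n≡m c≤a) (m∸n+n≡m c≤b) (+-monoˡ-≤ c le)

m≤n+o⇒m∸o≤n : ∀ {m} n o → m ≤ n + o → m ∸ o ≤ n
m≤n+o⇒m∸o≤n {m} n o le = m≤n+o⇒m∸n≤o m o (subst (m ≤_) (+-comm n o) le)

contraction : Matroid n → Fin n → Matroid n
contraction {n} M e = record
  { rk        = λ X → r (X ∪ ⁅ e ⁆) ∸ r ⁅ e ⁆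
  ; rk-card   = λ X → m≤n+o⇒m∸o≤n _ _ (≤-trans (rk-∪≤ X ⁅ e ⁆) (+-monoˡ-≤ _ (rk-card M X)))
  ; rk-mono   = λ X Y X⊆Y → ∸-monoˡ-≤ (r ⁅ e ⁆) (mono (⊆-solve ((v₀ , v₁) ∷ []) (v₀ ∪ₑ v₂) (v₁ ∪ₑ v₂)
                                                           (X ∷ Y ∷ ⁅ e ⁆ ∷ []) refl (X⊆Y , tt)))
  ; rk-submod = submod
  }
  where
  open RankFunction M
  rk-e≤ : ∀ X → r ⁅ e ⁆ ≤ r (X ∪ ⁅ e ⁆)
  rk-e≤ X = mono (q⊆p∪q X ⁅ e ⁆)
  submod : ∀ X Y → (r ((X ∪ Y) ∪ ⁅ e ⁆) ∸ r ⁅ e ⁆) + (r ((X ∩ Y) ∪ ⁅ e ⁆) ∸ r ⁅ e ⁆)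
                 ≤ (r (X ∪ ⁅ e ⁆) ∸ r ⁅ e ⁆) + (r (Y ∪ ⁅ e ⁆) ∸ r ⁅ e ⁆)
  submod X Y = ∸-preserves-+≤ _ _ _ _ _ (rk-e≤ _) (rk-e≤ _) (rk-e≤ _) (rk-e≤ _)
    (≤-trans (+-mono-≤ (mono (⊆-solve [] ((v₀ ∪ₑ v₁) ∪ₑ v₂) ((v₀ ∪ₑ v₂) ∪ₑ (v₁ ∪ₑ v₂)) ρ refl tt))
                       (mono (⊆-solve [] ((v₀ ∩ₑ v₁) ∪ₑ v₂) ((v₀ ∪ₑ v₂) ∩ₑ (v₁ ∪ₑ v₂)) ρ refl tt)))
             (rk-submod M (X ∪ ⁅ e ⁆) (Y ∪ ⁅ e ⁆)))
    where ρ = X ∷ Y ∷ ⁅ e ⁆ ∷ []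

dual : Matroid n → Matroid n
dual {n} M = record
  { rk        = λ X → ∣ X ∣ + r (∁ X) ∸ r ⊤
  ; rk-card   = λ X → m≤n+o⇒m∸o≤n _ _ (+-monoʳ-≤ ∣ X ∣ (mono ⊆⊤))
  ; rk-mono   = λ X Y X⊆Y → ∸-monoˡ-≤ (r ⊤) (mono-sum X⊆Y)
  ; rk-submod = submod
  }
  where
  open RankFunction M
  mono-sum : ∀ {X Y} → X ⊆ Y → ∣ X ∣ + r (∁ X) ≤ ∣ Y ∣ + r (∁ Y)
  mono-sum {X} {Y} X⊆Y = begin
    ∣ X ∣ + r (∁ X)                 ≤⟨ +-monoʳ-≤ ∣ X ∣ (≤-trans (mono ∁X⊆) (≤-trans (rk-∪≤ _ _) (+-monoʳ-≤ _ (rk-card M _)))) ⟩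
    ∣ X ∣ + (r (∁ Y) + ∣ Y ─ X ∣)   ≡⟨ cong (∣ X ∣ +_) (+-comm (r (∁ Y)) ∣ Y ─ X ∣) ⟩
    ∣ X ∣ + (∣ Y ─ X ∣ + r (∁ Y))   ≡⟨ +-assoc ∣ X ∣ ∣ Y ─ X ∣ (r (∁ Y)) ⟨
    (∣ X ∣ + ∣ Y ─ X ∣) + r (∁ Y)   ≡⟨ cong (λ Z → (∣ Z ∣ + ∣ Y ─ X ∣) + r (∁ Y)) Y∩X≡X ⟨
    (∣ Y ∩ X ∣ + ∣ Y ─ X ∣) + r (∁ Y) ≡⟨ cong (_+ r (∁ Y)) (∣p∣≡∣p∩q∣+∣p─q∣ Y X) ⟨
    ∣ Y ∣ + r (∁ Y)                 ∎
    where
    open ≤-Reasoning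
    ∁X⊆ : ∁ X ⊆ ∁ Y ∪ (Y ─ X)
    ∁X⊆ = ⊆-solve [] (∁ₑ v₀) (∁ₑ v₁ ∪ₑ (v₁ ─ₑ v₀)) (X ∷ Y ∷ []) refl tt
    Y∩X≡X : Y ∩ X ≡ X
    Y∩X≡X = ≡-solve ((v₀ , v₁) ∷ []) (v₁ ∩ₑ v₀) v₀ (X ∷ Y ∷ []) refl refl (X⊆Y , tt)
  submod : ∀ X Y → (∣ X ∪ Y ∣ + r (∁ (X ∪ Y)) ∸ r ⊤) + (∣ X ∩ Y ∣ + r (∁ (X ∩ Y)) ∸ r ⊤)
                 ≤ (∣ X ∣ + r (∁ X) ∸ r ⊤) + (∣ Y ∣ + r (∁ Y) ∸ r ⊤)
  submod X Y = ∸-preserves-+≤ _ _ _ _ _ (rk⊤≤∣X∣+rk∁X _) (rk⊤≤∣X∣+rk∁X _) (rk⊤≤∣X∣+rk∁X _) (rk⊤≤∣X∣+rk∁X _) (begin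
    (∣ X ∪ Y ∣ + r (∁ (X ∪ Y))) + (∣ X ∩ Y ∣ + r (∁ (X ∩ Y))) ≡⟨ +-interchange (∣ X ∪ Y ∣) (r (∁ (X ∪ Y))) (∣ X ∩ Y ∣) (r (∁ (X ∩ Y))) ⟩
    (∣ X ∪ Y ∣ + ∣ X ∩ Y ∣) + (r (∁ (X ∪ Y)) + r (∁ (X ∩ Y))) ≤⟨ +-mono-≤ (≤-reflexive (∣p∪q∣+∣p∩q∣≡∣p∣+∣q∣ X Y)) complements ⟩
    (∣ X ∣ + ∣ Y ∣) + (r (∁ X) + r (∁ Y))                     ≡⟨ +-interchange (∣ X ∣) (∣ Y ∣) (r (∁ X)) (r (∁ Y)) ⟩
    (∣ X ∣ + r (∁ X)) + (∣ Y ∣ + r (∁ Y))                     ∎)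
    where
    open ≤-Reasoning
    ρ = X ∷ Y ∷ []
    complements : r (∁ (X ∪ Y)) + r (∁ (X ∩ Y)) ≤ r (∁ X) + r (∁ Y)
    complements = ≤-trans
      (+-mono-≤ (mono (⊆-solve [] (∁ₑ (v₀ ∪ₑ v₁)) (∁ₑ v₀ ∩ₑ ∁ₑ v₁) ρ refl tt))
                (mono (⊆-solve [] (∁ₑ (v₀ ∩ₑ v₁)) (∁ₑ v₀ ∪ₑ ∁ₑ v₁) ρ refl tt)))
      (subst (_≤ r (∁ X) + r (∁ Y)) (+-comm (r (∁ X ∪ ∁ Y)) (r (∁ X ∩ ∁ Y))) (rk-submod M (∁ X) (∁ Y)))

module Duality {n : ℕ} (M : Matroid n) where

  open RankFunction M
  open Flats M
  module Dual = Flats (dual M)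

  r* : Subset n → ℕ
  r* = rk (dual M)

  Series : Fin n → Fin n → Set
  Series e f = ¬ f ≡ e × r (⊤ - e - f) < r ⊤

  private
    ∣⁅e⁆∪⁅f⁆∣≡2 : ∀ {e f : Fin n} → ¬ f ≡ e → ∣ ⁅ e ⁆ ∪ ⁅ f ⁆ ∣ ≡ 2
    ∣⁅e⁆∪⁅f⁆∣≡2 {e} {f} f≢e = trans (x∉p⇒∣p∪⁅x⁆∣≡1+∣p∣ (x≢y⇒x∉⁅y⁆ f≢e)) (cong suc (∣⁅x⁆∣≡1 e))

    ∁⁅e⁆∪⁅f⁆ : ∀ (e f : Fin n) → ∁ (⁅ e ⁆ ∪ ⁅ f ⁆) ≡ ⊤ - e - f
    ∁⁅e⁆∪⁅f⁆ e f = ≡-solve [] (∁ₑ (v₀ ∪ₑ v₁)) ((⊤ₑ ─ₑ v₀) ─ₑ v₁) (⁅ e ⁆ ∷ ⁅ f ⁆ ∷ []) refl refl tt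

    ∁⊤≡⊥ : ∁ (⊤ {n}) ≡ ⊥
    ∁⊤≡⊥ = ≡-solve [] (∁ₑ ⊤ₑ) ⊥ₑ ([] {A = Subset n}) refl refl tt

    ∁⊥≡⊤ : ∁ (⊥ {n}) ≡ ⊤
    ∁⊥≡⊤ = ≡-solve [] (∁ₑ ⊥ₑ) ⊤ₑ ([] {A = Subset n}) refl refl tt

    ∁∁p≡p : ∀ (p : Subset n) → ∁ (∁ p) ≡ p
    ∁∁p≡p p = ≡-solve [] (∁ₑ (∁ₑ v₀)) v₀ (p ∷ []) refl refl tt

    r*⁅e⁆∪⁅f⁆ : ∀ {e f} → ¬ f ≡ e → ∣ ⁅ e ⁆ ∪ ⁅ f ⁆ ∣ + r (∁ (⁅ e ⁆ ∪ ⁅ f ⁆)) ≡ 2 + r (⊤ - e - f)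
    r*⁅e⁆∪⁅f⁆ {e} {f} f≢e = cong₂ _+_ (∣⁅e⁆∪⁅f⁆∣≡2 f≢e) (cong r (∁⁅e⁆∪⁅f⁆ e f))

  r*⊤≡corank : r* ⊤ ≡ n ∸ r ⊤
  r*⊤≡corank = cong (_∸ r ⊤) (trans (cong₂ _+_ (∣⊤∣≡n n) (trans (cong r ∁⊤≡⊥) rk-⊥≡0)) (+-identityʳ n))

  coloopless⇒r*-loopless : (∀ e → r (⊤ - e) ≡ r ⊤) → ∀ e → r* ⁅ e ⁆ ≡ 1
  coloopless⇒r*-loopless coloopless e =
    trans (cong₂ (λ a b → a + b ∸ r ⊤) (∣⁅x⁆∣≡1 e) (trans (cong r ∁⁅e⁆) (coloopless e))) (m+n∸n≡m 1 (r ⊤))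
    where
    ∁⁅e⁆ : ∁ ⁅ e ⁆ ≡ ⊤ - e
    ∁⁅e⁆ = ≡-solve [] (∁ₑ v₀) (⊤ₑ ─ₑ v₀) (⁅ e ⁆ ∷ []) refl refl tt

  series⇒dual-parallel : ∀ {e f} → Series e f → Dual.Parallel e f
  series⇒dual-parallel {e} {f} (f≢e , drop) =
    f≢e , m≤n+o⇒m∸o≤n 1 (r ⊤) (subst (_≤ 1 + r ⊤) (sym (r*⁅e⁆∪⁅f⁆ f≢e)) (s≤s drop))

  dual-parallel⇒series : ∀ {e f} → Dual.Parallel e f → Series e f
  dual-parallel⇒series {e} {f} (f≢e , r*≤1) = f≢e , ≤-pred (subst (_≤ 1 + r ⊤) (r*⁅e⁆∪⁅f⁆ f≢e)
    (∸-reflects-≤ (r ⊤) (rk⊤≤∣X∣+rk∁X _) (m≤n+m (r ⊤) 1) (subst (r* (⁅ e ⁆ ∪ ⁅ f ⁆) ≤_) (sym (m+n∸n≡m 1 (r ⊤))) r*≤1)))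

  dual-cyclic⇒∁-flat : ∀ {F} → Dual.IsCyclic F → IsFlat (∁ F)
  dual-cyclic⇒∁-flat {F} cyc e e∉∁F = +-cancelˡ-≤ ∣ F - e ∣ _ _
    (subst₂ _≤_ lhs rhs (∸-reflects-≤ (r ⊤) (rk⊤≤∣X∣+rk∁X F) (rk⊤≤∣X∣+rk∁X (F - e)) (cyc e e∈F)))
    where
    e∈F : e ∈ F
    e∈F = x∉∁p⇒x∈p e∉∁F
    lhs : ∣ F ∣ + r (∁ F) ≡ ∣ F - e ∣ + suc (r (∁ F))
    lhs = trans (cong (_+ r (∁ F)) (x∈p⇒∣p∣≡1+∣p-x∣ e∈F)) (sym (+-suc _ _))
    rhs : ∣ F - e ∣ + r (∁ (F - e)) ≡ ∣ F - e ∣ + r (∁ F ∪ ⁅ e ⁆)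
    rhs = cong (λ Z → ∣ F - e ∣ + r Z) (≡-solve [] (∁ₑ (v₀ ─ₑ v₁)) (∁ₑ v₀ ∪ₑ v₁) (F ∷ ⁅ e ⁆ ∷ []) refl refl tt)

  dual-flat⇒∁-cyclic : ∀ {F} → Dual.IsFlat F → IsCyclic (∁ F)
  dual-flat⇒∁-cyclic {F} flat e e∈∁F = +-cancelˡ-≤ (suc ∣ F ∣) _ _
    (subst (suc (∣ F ∣ + r (∁ F)) ≤_) rhs
      (∸-reflects-≤ (r ⊤) (≤-trans (rk⊤≤∣X∣+rk∁X F) (n≤1+n _)) (rk⊤≤∣X∣+rk∁X (F ∪ ⁅ e ⁆))
                    (subst (_≤ r* (F ∪ ⁅ e ⁆)) (sym (+-∸-assoc 1 (rk⊤≤∣X∣+rk∁X F))) (flat e e∉F))))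
    where
    e∉F : e ∉ F
    e∉F = x∈∁p⇒x∉p e∈∁F
    rhs : ∣ F ∪ ⁅ e ⁆ ∣ + r (∁ (F ∪ ⁅ e ⁆)) ≡ suc ∣ F ∣ + r (∁ F - e)
    rhs = cong₂ _+_ (x∉p⇒∣p∪⁅x⁆∣≡1+∣p∣ e∉F) (cong r (≡-solve [] (∁ₑ (v₀ ∪ₑ v₁)) (∁ₑ v₀ ─ₑ v₁) (F ∷ ⁅ e ⁆ ∷ []) refl refl tt))

  split⇒dual-split : IsSplit → Dual.IsSplit
  split⇒dual-split split F₁ F₂ flat₁ cyc₁ flat₂ cyc₂ F₁⊂F₂
    with split (∁ F₂) (∁ F₁) (dual-cyclic⇒∁-flat cyc₂) (dual-flat⇒∁-cyclic flat₂)
               (dual-cyclic⇒∁-flat cyc₁) (dual-flat⇒∁-cyclic flat₁) (p⊂q⇒∁p⊃∁q F₁⊂F₂)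
  ... | inj₁ ∁F₂≡⊥ = inj₂ (trans (sym (∁∁p≡p F₂)) (trans (cong ∁ ∁F₂≡⊥) ∁⊥≡⊤))
  ... | inj₂ ∁F₁≡⊤ = inj₁ (trans (sym (∁∁p≡p F₁)) (trans (cong ∁ ∁F₁≡⊤) ∁⊤≡⊥))

-- The rank function of T_{k,m}

module BoolFacts where

  ∨-introˡ : ∀ {a b} → a ≡ true → a ∨ b ≡ true
  ∨-introˡ {true} _ = refl

  ∨-introʳ : ∀ {a b} → b ≡ true → a ∨ b ≡ true
  ∨-introʳ {true}  _  = refl
  ∨-introʳ {false} b≡ = b≡

  ∨-elim : ∀ {a b} → a ∨ b ≡ true → a ≡ true ⊎ b ≡ true
  ∨-elim {true}  _  = inj₁ refl
  ∨-elim {false} b≡ = inj₂ b≡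

  ∧-intro : ∀ {a b} → a ≡ true → b ≡ true → a ∧ b ≡ true
  ∧-intro refl b≡ = b≡

  ∧-elimˡ : ∀ {a b} → a ∧ b ≡ true → a ≡ true
  ∧-elimˡ {true} _ = refl

  ∧-elimʳ : ∀ {a b} → a ∧ b ≡ true → b ≡ true
  ∧-elimʳ {true} b≡ = b≡

  ≡true-ext : ∀ {a b : Bool} → (a ≡ true → b ≡ true) → (b ≡ true → a ≡ true) → a ≡ b
  ≡true-ext {true}          a⇒b _   = sym (a⇒b refl)
  ≡true-ext {false} {false} _   _   = refl
  ≡true-ext {false} {true}  _   b⇒a = b⇒a refl

  ≤ᵇ-true : ∀ {a b} → a ≤ b → (a ≤ᵇ b) ≡ true
  ≤ᵇ-true a≤b = Equivalence.to T-≡ (≤⇒≤ᵇ a≤b)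

  ≤ᵇ-false : ∀ {a b} → ¬ a ≤ b → (a ≤ᵇ b) ≡ false
  ≤ᵇ-false {a} {b} a≰b with a ≤ᵇ b in eq
  ... | false = refl
  ... | true  = ⊥-elim (a≰b (≤ᵇ⇒≤ a b (Equivalence.from T-≡ eq)))

  ≤ᵇ-sound : ∀ {a b} → (a ≤ᵇ b) ≡ true → a ≤ b
  ≤ᵇ-sound {a} {b} eq = ≤ᵇ⇒≤ a b (Equivalence.from T-≡ eq)

  anyFin⁺ : ∀ m (p : Fin m → Bool) j → p j ≡ true → anyFin m p ≡ true
  anyFin⁺ (suc m) p zero    pj = ∨-introˡ pj
  anyFin⁺ (suc m) p (suc j) pj = ∨-introʳ {p zero} (anyFin⁺ m (p ∘ suc) j pj)

  anyFin⁻ : ∀ m (p : Fin m → Bool) → anyFin m p ≡ true → ∃ λ j → p j ≡ true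
  anyFin⁻ (suc m) p any with ∨-elim {p zero} any
  ... | inj₁ p0 = zero , p0
  ... | inj₂ ps with anyFin⁻ m (p ∘ suc) ps
  ...   | j , pj = suc j , pj

  allFin⁺ : ∀ m (p : Fin m → Bool) → (∀ j → p j ≡ true) → allFin m p ≡ true
  allFin⁺ zero    p _   = refl
  allFin⁺ (suc m) p all = ∧-intro (all zero) (allFin⁺ m (p ∘ suc) (all ∘ suc))

  allFin⁻ : ∀ m (p : Fin m → Bool) → allFin m p ≡ true → ∀ j → p j ≡ true
  allFin⁻ (suc m) p all zero    = ∧-elimˡ all
  allFin⁻ (suc m) p all (suc j) = allFin⁻ m (p ∘ suc) (∧-elimʳ {p zero} all) j

open BoolFacts

module Components {V m : ℕ} (ends : Fin m → Fin V × Fin V) (X : Subset m) where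

  open Graphic ends

  _⊆ᵛ_ : Subset V → Subset V → Set
  A ⊆ᵛ B = ∀ w → lookup A w ≡ true → lookup B w ≡ true

  Closed : Subset V → Set
  Closed C = ∀ j → lookup X j ≡ true → lookup C (proj₁ (ends j)) ≡ lookup C (proj₂ (ends j))

  ==-sound : ∀ {a b : Fin V} → (a == b) ≡ true → a ≡ b
  ==-sound {a} {b} eq with a ≟ᶠ b
  ... | yes a≡b = a≡b

  ==-refl : ∀ (a : Fin V) → (a == a) ≡ true
  ==-refl a with a ≟ᶠ a
  ... | yes _   = refl
  ... | no  a≢a = ⊥-elim (a≢a refl)

  closed-along : ∀ {C} → Closed C → ∀ j {a b} → ends j ≡ (a , b) → lookup X j ≡ true → lookup C a ≡ lookup C b
  closed-along {C} closed j ends-j j∈X = subst (λ e → lookup C (proj₁ e) ≡ lookup C (proj₂ e)) ends-j (closed j j∈X)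

  lookup-step : ∀ R w → lookup (step X R) w ≡ lookup R w ∨ adj X R w
  lookup-step R w = lookup∘tabulate _ w

  step-⊆closed : ∀ {C R} → Closed C → R ⊆ᵛ C → step X R ⊆ᵛ C
  step-⊆closed {C} {R} closed R⊆C w w∈ with ∨-elim (trans (sym (lookup-step R w)) w∈)
  ... | inj₁ w∈R = R⊆C w w∈R
  ... | inj₂ w∈adj with anyFin⁻ m _ w∈adj
  ...   | j , edge with ends j in ends-j | ∧-elimʳ {lookup X j} edge
  ...     | a , b | from-a-or-b with ∨-elim from-a-or-b
  ...       | inj₁ from-a = subst (λ u → lookup C u ≡ true) (==-sound (∧-elimʳ {lookup R a} from-a))
                              (trans (sym (closed-along {C} closed j ends-j (∧-elimˡ edge))) (R⊆C a (∧-elimˡ from-a)))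
  ...       | inj₂ from-b = subst (λ u → lookup C u ≡ true) (==-sound (∧-elimʳ {lookup R b} from-b))
                              (trans (closed-along {C} closed j ends-j (∧-elimˡ edge)) (R⊆C b (∧-elimˡ from-b)))

  iter-⊆closed : ∀ {C R} t → Closed C → R ⊆ᵛ C → iter t X R ⊆ᵛ C
  iter-⊆closed zero    closed R⊆C = R⊆C
  iter-⊆closed {C} {R} (suc t) closed R⊆C = step-⊆closed {C} {iter t X R} closed (iter-⊆closed {C} {R} t closed R⊆C)

  step-extends : ∀ R → R ⊆ᵛ step X R
  step-extends R w w∈R = trans (lookup-step R w) (∨-introˡ w∈R)

  iter-mono : ∀ R t d → iter t X R ⊆ᵛ iter (d + t) X R
  iter-mono R t zero    w w∈ = w∈
  iter-mono R t (suc d) w w∈ = step-extends (iter (d + t) X R) w (iter-mono R t d w w∈)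

  step-forward : ∀ R j → lookup X j ≡ true → lookup R (proj₁ (ends j)) ≡ true → lookup (step X R) (proj₂ (ends j)) ≡ true
  step-forward R j j∈X a∈R = trans (lookup-step R _) (∨-introʳ {lookup R (proj₂ (ends j))}
    (anyFin⁺ m _ j (∧-intro j∈X (∨-introˡ (∧-intro a∈R (==-refl (proj₂ (ends j))))))))

  step-backward : ∀ R j → lookup X j ≡ true → lookup R (proj₂ (ends j)) ≡ true → lookup (step X R) (proj₁ (ends j)) ≡ true
  step-backward R j j∈X b∈R = trans (lookup-step R _) (∨-introʳ {lookup R (proj₁ (ends j))}
    (anyFin⁺ m _ j (∧-intro j∈X (∨-introʳ {lookup R (proj₁ (ends j)) ∧ (proj₂ (ends j) == proj₁ (ends j))}
                                            (∧-intro b∈R (==-refl (proj₁ (ends j))))))))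

  isRoot-true : ∀ v C → Closed C → lookup C v ≡ true → (∀ w → lookup C w ≡ true → toℕ v ≤ toℕ w) → isRoot X v ≡ true
  isRoot-true v C closed v∈C v-least = allFin⁺ V _ λ w → least w
    where
    component⊆C : component X v ⊆ᵛ C
    component⊆C = iter-⊆closed {C} {⁅ v ⁆} V closed λ w w∈ → subst (λ u → lookup C u ≡ true) (sym (x∈⁅y⁆⇒x≡y v (lookup⇒∈ w∈))) v∈C
    least : ∀ w → (if lookup (component X v) w then toℕ v ≤ᵇ toℕ w else true) ≡ true
    least w with lookup (component X v) w in w∈
    ... | false = refl
    ... | true  = ≤ᵇ-true (v-least w (component⊆C w w∈))

  isRoot-false : ∀ v w → lookup (component X v) w ≡ true → toℕ w < toℕ v → isRoot X v ≡ false
  isRoot-false v w w∈ w<v with isRoot X v in root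
  ... | false = refl
  ... | true with allFin⁻ V _ root w
  ...   | v≤w rewrite w∈ = ⊥-elim (<⇒≱ w<v (≤ᵇ-sound v≤w))

module BitCounting where

  bit : ∀ {m} → Subset m → ℕ → Bool
  bit []      i       = false
  bit (b ∷ Y) zero    = b
  bit (b ∷ Y) (suc i) = bit Y i

  lookup≡bit : ∀ {m} (Y : Subset m) j → lookup Y j ≡ bit Y (toℕ j)
  lookup≡bit (b ∷ Y) zero    = refl
  lookup≡bit (b ∷ Y) (suc j) = lookup≡bit Y j

  bit⇒lookup : ∀ {m} (Y : Subset m) i → bit Y i ≡ true → ∃ λ (j : Fin m) → toℕ j ≡ i × lookup Y j ≡ true
  bit⇒lookup (b ∷ Y) zero    b≡ = zero , refl , b≡
  bit⇒lookup (b ∷ Y) (suc i) b≡ with bit⇒lookup Y i b≡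
  ... | j , j≡i , j∈Y = suc j , cong suc j≡i , j∈Y

  𝟙 : Bool → ℕ
  𝟙 true  = 1
  𝟙 false = 0

  countTrue : ℕ → (ℕ → Bool) → ℕ
  countTrue zero    g = 0
  countTrue (suc l) g = 𝟙 (g 0) + countTrue l (g ∘ suc)

  allTrue : ℕ → (ℕ → Bool) → Bool
  allTrue zero    g = true
  allTrue (suc l) g = g 0 ∧ allTrue l (g ∘ suc)

  count-tabulate : ∀ l (g : ℕ → Bool) → count (λ b → b Data.Bool.≟ true) (tabulate {n = l} (g ∘ toℕ)) ≡ countTrue l g
  count-tabulate zero    g = refl
  count-tabulate (suc l) g with g 0
  ... | true  = cong suc (count-tabulate l (g ∘ suc))
  ... | false = count-tabulate l (g ∘ suc)

  ∣Y∩[<k]∣≡countTrue : ∀ {m} (Y : Subset m) k → ∣ Y ∩ tabulate (λ j → toℕ j <ᵇ k) ∣ ≡ countTrue k (bit Y)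
  ∣Y∩[<k]∣≡countTrue []      zero    = refl
  ∣Y∩[<k]∣≡countTrue []      (suc k) = ∣Y∩[<k]∣≡countTrue [] k
  ∣Y∩[<k]∣≡countTrue (b ∷ Y) zero with b
  ... | true  = ∣Y∩[<k]∣≡countTrue Y zero
  ... | false = ∣Y∩[<k]∣≡countTrue Y zero
  ∣Y∩[<k]∣≡countTrue (true  ∷ Y) (suc k) = cong suc (∣Y∩[<k]∣≡countTrue Y k)
  ∣Y∩[<k]∣≡countTrue (false ∷ Y) (suc k) = ∣Y∩[<k]∣≡countTrue Y k

  allTrue⁻ : ∀ l g → allTrue l g ≡ true → ∀ d → d < l → g d ≡ true
  allTrue⁻ (suc l) g all zero    _         = ∧-elimˡ all
  allTrue⁻ (suc l) g all (suc d) (s≤s d<l) = allTrue⁻ l (g ∘ suc) (∧-elimʳ {g 0} all) d d<l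

  ¬allTrue⁻ : ∀ l g → allTrue l g ≡ false → ∃ λ d → d < l × g d ≡ false
  ¬allTrue⁻ (suc l) g ¬all with g 0 in g0
  ... | false = 0 , s≤s z≤n , g0
  ... | true with ¬allTrue⁻ l (g ∘ suc) ¬all
  ...   | d , d<l , gd = suc d , s≤s d<l , gd

  countTrue+countFalse : ∀ l g → countTrue l g + countTrue l (not ∘ g) ≡ l
  countTrue+countFalse zero    g = refl
  countTrue+countFalse (suc l) g with g 0
  ... | true  = cong suc (countTrue+countFalse l (g ∘ suc))
  ... | false = trans (+-suc _ _) (cong suc (countTrue+countFalse l (g ∘ suc)))

  allTrue⇒countTrue≡ : ∀ l g → allTrue l g ≡ true → countTrue l g ≡ l
  allTrue⇒countTrue≡ zero    g _   = refl
  allTrue⇒countTrue≡ (suc l) g all with g 0 | all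
  ... | true | all′ = cong suc (allTrue⇒countTrue≡ l (g ∘ suc) all′)

  ¬allTrue⇒countTrue< : ∀ l g → allTrue l g ≡ false → countTrue l g < l
  ¬allTrue⇒countTrue< (suc l) g ¬all with g 0 | ¬all
  ... | false | _     = s≤s (≤-trans (m≤m+n (countTrue l (g ∘ suc)) _) (≤-reflexive (countTrue+countFalse l (g ∘ suc))))
  ... | true  | ¬all′ = s≤s (¬allTrue⇒countTrue< l (g ∘ suc) ¬all′)

  -- Among the false positions of x below l, exactly the last one has only true positions after it
  -- (there is such a position iff x is not everywhere true).
  last-false-count : ∀ (b : Bool) x l →
    countTrue l (λ i → not (x i) ∧ not (b ∧ allTrue (l ∸ suc i) (λ d → x (suc i + d)))) + 𝟙 (b ∧ not (allTrue l x))
      ≡ countTrue l (not ∘ x)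
  last-false-count b x zero with b
  ... | true  = refl
  ... | false = refl
  last-false-count b x (suc l) with x 0 | last-false-count b (x ∘ suc) l
  ... | true  | ih = ih
  ... | false | ih with b | allTrue l (x ∘ suc)
  ...   | true  | true  = trans (+-comm _ 1) (cong suc (trans (sym (+-identityʳ _)) ih))
  ...   | true  | false = cong suc ih
  ...   | false | true  = cong suc ih
  ...   | false | false = cong suc ih

open BitCounting

pathEdges : (k m : ℕ) → Subset m
pathEdges k m = tabulate (λ j → toℕ j <ᵇ k)

module MinimalGraph (k m : ℕ) (Y : Subset m) where

  open Graphic (T-ends k m)
  open Components (T-ends k m) Y

  ends-path : ∀ j → toℕ j < k → toℕ (proj₁ (T-ends k m j)) ≡ toℕ j × toℕ (proj₂ (T-ends k m j)) ≡ suc (toℕ j)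
  ends-path j j<k with toℕ j <? k
  ... | yes j<k′ = toℕ-fromℕ< (m<n⇒m<1+n j<k′) , toℕ-fromℕ< (s≤s j<k′)
  ... | no  j≮k  = ⊥-elim (j≮k j<k)

  ends-parallel : ∀ j → ¬ toℕ j < k → T-ends k m j ≡ (fromℕ k , zero)
  ends-parallel j j≮k with toℕ j <? k
  ... | yes j<k = ⊥-elim (j≮k j<k)
  ... | no  _   = refl

  path-or-parallel : ∀ (j : Fin m) → toℕ j < k ⊎ ¬ toℕ j < k
  path-or-parallel j with toℕ j <? k
  ... | yes j<k = inj₁ j<k
  ... | no  j≮k = inj₂ j≮k

  chosen : ℕ → Bool
  chosen = bit Y

  parallelChosen : Bool
  parallelChosen = anyFin m (λ j → lookup Y j ∧ not (toℕ j <ᵇ k))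

  chosen⇒edge : ∀ i → chosen i ≡ true → ∃ λ j → toℕ j ≡ i × lookup Y j ≡ true
  chosen⇒edge = bit⇒lookup Y

  inInterval : ℕ → ℕ → ℕ → Bool
  inInterval i z t = (suc i ≤ᵇ t) ∧ (t ≤ᵇ z)

  interval : ℕ → ℕ → Subset (suc k)
  interval i z = tabulate (λ w → inInterval i z (toℕ w))

  lookup-interval : ∀ i z w → lookup (interval i z) w ≡ inInterval i z (toℕ w)
  lookup-interval i z w = lookup∘tabulate (λ w → inInterval i z (toℕ w)) w

  -- The vertices i+1, …, z are cut off from the rest when the path edges i and z are not chosen
  -- (z = k instead needs no parallel edge to be chosen).
  interval-closed : ∀ i z → chosen i ≡ false → (z < k → chosen z ≡ false) → (parallelChosen ≡ true → z < k) →
                    Closed (interval i z)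
  interval-closed i z i∉Y z∉Y parallel⇒z<k j j∈Y with path-or-parallel j
  ... | inj₁ j<k =
    trans (lookup-interval i z (proj₁ (T-ends k m j))) (trans (cong (inInterval i z) a≡j)
      (trans same-side (trans (cong (inInterval i z) (sym b≡1+j)) (sym (lookup-interval i z (proj₂ (T-ends k m j)))))))
    where
    t = toℕ j
    a≡j = proj₁ (ends-path j j<k)
    b≡1+j = proj₂ (ends-path j j<k)
    t∈Y : chosen t ≡ true
    t∈Y = trans (sym (lookup≡bit Y j)) j∈Y
    t≢i : ¬ t ≡ i
    t≢i refl with trans (sym t∈Y) i∉Y
    ... | ()
    t≢z : ¬ t ≡ z
    t≢z refl with trans (sym t∈Y) (z∉Y j<k)
    ... | ()
    same-side : inInterval i z t ≡ inInterval i z (suc t)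
    same-side = ≡true-ext
      (λ t∈ → ∧-intro (≤ᵇ-true {suc i} {suc t} (m≤n⇒m≤1+n (≤ᵇ-sound {suc i} {t} (∧-elimˡ {suc i ≤ᵇ t} t∈))))
                      (≤ᵇ-true {suc t} {z} (≤∧≢⇒< (≤ᵇ-sound {t} {z} (∧-elimʳ {suc i ≤ᵇ t} t∈)) t≢z)))
      (λ t+1∈ → ∧-intro (≤ᵇ-true {suc i} {t} (≤∧≢⇒< (≤-pred (≤ᵇ-sound {suc i} {suc t} (∧-elimˡ {suc i ≤ᵇ suc t} t+1∈))) (t≢i ∘ sym)))
                        (≤ᵇ-true {t} {z} (≤-trans (n≤1+n t) (≤ᵇ-sound {suc t} {z} (∧-elimʳ {suc i ≤ᵇ suc t} t+1∈)))))
  ... | inj₂ j≮k rewrite ends-parallel j j≮k =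
    trans (lookup-interval i z (fromℕ k)) (trans k∉ (sym (lookup-interval i z zero)))
    where
    z<k : z < k
    z<k = parallel⇒z<k (anyFin⁺ m _ j (∧-intro j∈Y (cong not (≤ᵇ-false j≮k))))
    k∉ : inInterval i z (toℕ (fromℕ k)) ≡ inInterval i z 0
    k∉ rewrite toℕ-fromℕ k | ≤ᵇ-false {k} {z} (<⇒≱ z<k) with suc i ≤ᵇ k
    ... | true  = refl
    ... | false = refl

  isRoot-zero : isRoot Y zero ≡ true
  isRoot-zero = isRoot-true zero ⊤ (λ j _ → trans (lookup-replicate (proj₁ (T-ends k m j)) true)
                                                 (sym (lookup-replicate (proj₂ (T-ends k m j)) true)))
                            (lookup-replicate {n = suc k} zero true) (λ _ _ → z≤n)

  reach⇒component : ∀ v t d → d + t ≡ suc k → ∀ w → lookup (iter t Y ⁅ v ⁆) w ≡ true → lookup (component Y v) w ≡ true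
  reach⇒component v t d d+t≡V w w∈ = subst (λ s → lookup (iter s Y ⁅ v ⁆) w ≡ true) d+t≡V (iter-mono ⁅ v ⁆ t d w w∈)

  interval-root : ∀ (i : Fin k) z → toℕ i < z → Closed (interval (toℕ i) z) → z ≤ k → isRoot Y (suc i) ≡ true
  interval-root i z i<z closed z≤k = isRoot-true (suc i) (interval (toℕ i) z) closed i+1∈
    (λ w w∈ → ≤ᵇ-sound {suc (toℕ i)} {toℕ w} (∧-elimˡ {suc (toℕ i) ≤ᵇ toℕ w} (trans (sym (lookup-interval (toℕ i) z w)) w∈)))
    where
    i+1∈ : lookup (interval (toℕ i) z) (suc i) ≡ true
    i+1∈ = trans (lookup-interval (toℕ i) z (suc i)) (∧-intro (≤ᵇ-true {suc (toℕ i)} ≤-refl) (≤ᵇ-true {suc (toℕ i)} {z} i<z))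

  chosen⇒¬root : ∀ (i : Fin k) → chosen (toℕ i) ≡ true → isRoot Y (suc i) ≡ false
  chosen⇒¬root i i∈Y with chosen⇒edge (toℕ i) i∈Y
  ... | j , j≡i , j∈Y = isRoot-false (suc i) (proj₁ (T-ends k m j)) i∈component (s≤s (≤-reflexive a≡i))
    where
    j<k : toℕ j < k
    j<k = subst (_< k) (sym j≡i) (toℕ<n i)
    a≡i : toℕ (proj₁ (T-ends k m j)) ≡ toℕ i
    a≡i = trans (proj₁ (ends-path j j<k)) j≡i
    b≡i+1 : proj₂ (T-ends k m j) ≡ suc i
    b≡i+1 = toℕ-injective (trans (proj₂ (ends-path j j<k)) (cong suc j≡i))
    i∈component : lookup (component Y (suc i)) (proj₁ (T-ends k m j)) ≡ true
    i∈component = reach⇒component (suc i) 1 k (+-comm k 1) (proj₁ (T-ends k m j))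
      (step-backward ⁅ suc i ⁆ j j∈Y (subst (λ u → lookup ⁅ suc i ⁆ u ≡ true) (sym b≡i+1) (∈⇒lookup (x∈⁅x⁆ (suc i)))))

  walk : ∀ (i : Fin k) → allTrue (k ∸ suc (toℕ i)) (λ d → chosen (suc (toℕ i) + d)) ≡ true →
         ∀ d → d ≤ k ∸ suc (toℕ i) → ∀ w → toℕ w ≡ suc (toℕ i) + d → lookup (iter d Y ⁅ suc i ⁆) w ≡ true
  walk i all zero    _   w w≡ = subst (λ u → lookup ⁅ suc i ⁆ u ≡ true)
                                      (toℕ-injective (sym (trans w≡ (+-identityʳ (suc (toℕ i)))))) (∈⇒lookup (x∈⁅x⁆ (suc i)))
  walk i all (suc d) d<  w w≡ with chosen⇒edge (suc (toℕ i) + d) (allTrue⁻ _ _ all d d<)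
  ... | j , j≡ , j∈Y = subst (λ u → lookup (iter (suc d) Y ⁅ suc i ⁆) u ≡ true) b≡w
        (step-forward (iter d Y ⁅ suc i ⁆) j j∈Y (walk i all d (≤-trans (n≤1+n d) d<) _ (trans (proj₁ (ends-path j j<k)) j≡)))
    where
    j<k : toℕ j < k
    j<k = subst (_< k) (sym j≡) (subst (suc (toℕ i) + d <_) (m+[n∸m]≡n (toℕ<n i)) (+-monoʳ-< (suc (toℕ i)) d<))
    b≡w : proj₂ (T-ends k m j) ≡ w
    b≡w = toℕ-injective (trans (proj₂ (ends-path j j<k)) (trans (cong suc j≡) (trans (sym (+-suc (suc (toℕ i)) d)) (sym w≡))))

  wraps⇒¬root : ∀ (i : Fin k) → parallelChosen ≡ true → allTrue (k ∸ suc (toℕ i)) (λ d → chosen (suc (toℕ i) + d)) ≡ true →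
                isRoot Y (suc i) ≡ false
  wraps⇒¬root i parallel all with anyFin⁻ m _ parallel
  ... | j , j-parallel = isRoot-false (suc i) zero zero∈component (s≤s z≤n)
    where
    D = k ∸ suc (toℕ i)
    j∈Y : lookup Y j ≡ true
    j∈Y = ∧-elimˡ j-parallel
    j≮k : ¬ toℕ j < k
    j≮k j<k with trans (sym j-parallel) (cong (λ b → lookup Y j ∧ not b) (≤ᵇ-true {suc (toℕ j)} j<k))
    ... | eq with lookup Y j
    j≮k j<k | () | true
    j≮k j<k | () | false
    top∈ : lookup (iter D Y ⁅ suc i ⁆) (fromℕ k) ≡ true
    top∈ = walk i all D ≤-refl (fromℕ k) (trans (toℕ-fromℕ k) (sym (m+[n∸m]≡n (toℕ<n i))))
    zero∈component : lookup (component Y (suc i)) zero ≡ true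
    zero∈component = reach⇒component (suc i) (suc D) (suc (toℕ i)) (trans (+-suc (suc (toℕ i)) D) (cong suc (m+[n∸m]≡n (toℕ<n i)))) zero
      (subst (λ e → lookup (iter (suc D) Y ⁅ suc i ⁆) (proj₂ e) ≡ true) (ends-parallel j j≮k)
        (step-forward (iter D Y ⁅ suc i ⁆) j j∈Y (subst (λ e → lookup (iter D Y ⁅ suc i ⁆) (proj₁ e) ≡ true) (sym (ends-parallel j j≮k)) top∈)))

  -- Vertex i+1 is a root unless path edge i is chosen, or the chosen path edges above it reach
  -- vertex k and a chosen parallel edge leads on to vertex 0.
  rootFlag : ℕ → Bool
  rootFlag i = not (chosen i) ∧ not (parallelChosen ∧ allTrue (k ∸ suc i) (λ d → chosen (suc i + d)))

  isRoot-suc : ∀ (i : Fin k) → isRoot Y (suc i) ≡ rootFlag (toℕ i)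
  isRoot-suc i with chosen (toℕ i) in i∈Y
  ... | true  = chosen⇒¬root i i∈Y
  ... | false with parallelChosen in parallel | allTrue (k ∸ suc (toℕ i)) (λ d → chosen (suc (toℕ i) + d)) in all
  ...   | true  | true  = wraps⇒¬root i parallel all
  ...   | true  | false with ¬allTrue⁻ _ _ all
  ...     | d , d< , gap = interval-root i z (s≤s (m≤m+n (toℕ i) d)) (interval-closed (toℕ i) z i∈Y (λ _ → gap) (λ _ → z<k)) (<⇒≤ z<k)
    where
    z = suc (toℕ i) + d
    z<k : z < k
    z<k = subst (z <_) (m+[n∸m]≡n (toℕ<n i)) (+-monoʳ-< (suc (toℕ i)) d<)
  isRoot-suc i | false | false | _ =
    interval-root i k (toℕ<n i) (interval-closed (toℕ i) k i∈Y (λ k<k → ⊥-elim (<-irrefl refl k<k)) (λ p → case trans (sym parallel) p of λ ())) ≤-refl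

  T-rank≡ : T-rank k m Y ≡ ∣ Y ∩ pathEdges k m ∣ + 𝟙 (parallelChosen ∧ not (allTrue k chosen))
  T-rank≡ = begin
    suc k ∸ components Y                    ≡⟨ cong (suc k ∸_) components≡ ⟩
    k ∸ countTrue k rootFlag                ≡⟨ cong (_∸ countTrue k rootFlag) (countTrue+countFalse k chosen) ⟨
    (a + countTrue k (not ∘ chosen)) ∸ F    ≡⟨ cong (λ s → (a + s) ∸ F) (last-false-count parallelChosen chosen k) ⟨
    (a + (F + c)) ∸ F                       ≡⟨ cong (_∸ F) (trans (cong (a +_) (+-comm F c)) (sym (+-assoc a c F))) ⟩
    (a + c + F) ∸ F                         ≡⟨ m+n∸n≡m (a + c) F ⟩
    a + c                                   ≡⟨ cong (_+ c) (∣Y∩[<k]∣≡countTrue Y k) ⟨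
    ∣ Y ∩ pathEdges k m ∣ + c               ∎
    where
    open ≡-Reasoning
    a = countTrue k chosen
    c = 𝟙 (parallelChosen ∧ not (allTrue k chosen))
    F = countTrue k rootFlag
    components≡ : components Y ≡ suc (countTrue k rootFlag)
    components≡ = trans (cong (count (λ b → b Data.Bool.≟ true)) (cong₂ _∷_ isRoot-zero (tabulate-cong isRoot-suc)))
                        (cong suc (count-tabulate k rootFlag))

  lookup-pathEdges : ∀ j → lookup (pathEdges k m) j ≡ (toℕ j <ᵇ k)
  lookup-pathEdges j = lookup∘tabulate (λ j → toℕ j <ᵇ k) j

  ⊆path⇒¬parallelChosen : Y ⊆ pathEdges k m → parallelChosen ≡ false
  ⊆path⇒¬parallelChosen Y⊆path with parallelChosen in parallel
  ... | false = refl
  ... | true with anyFin⁻ m _ parallel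
  ...   | j , j-parallel
    with trans (sym (cong not (trans (sym (lookup-pathEdges j)) (∈⇒lookup (Y⊆path (lookup⇒∈ (∧-elimˡ j-parallel)))))))
               (∧-elimʳ {lookup Y j} j-parallel)
  ...     | ()

  ∉path⇒parallelChosen : ∀ {x} → x ∈ Y → x ∉ pathEdges k m → parallelChosen ≡ true
  ∉path⇒parallelChosen {x} x∈Y x∉path =
    anyFin⁺ m _ x (∧-intro (∈⇒lookup x∈Y) (cong not (trans (sym (lookup-pathEdges x)) (∉⇒lookup x∉path))))

  short⇒¬allChosen : ∣ Y ∩ pathEdges k m ∣ < k → allTrue k chosen ≡ false
  short⇒¬allChosen short with allTrue k chosen in all
  ... | false = refl
  ... | true  = ⊥-elim (<-irrefl (trans (∣Y∩[<k]∣≡countTrue Y k) (allTrue⇒countTrue≡ k chosen all)) short)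

  long⇒allChosen : k ≤ ∣ Y ∩ pathEdges k m ∣ → allTrue k chosen ≡ true
  long⇒allChosen long with allTrue k chosen in all
  ... | true  = refl
  ... | false = ⊥-elim (<⇒≱ (subst (_< k) (sym (∣Y∩[<k]∣≡countTrue Y k)) (¬allTrue⇒countTrue< k chosen all)) long)

-- The rank function of a copy of T_{k,·} whose path edges form S and whose parallel edges form ∁ S.
record MinimalRank {n : ℕ} (S : Subset n) (k : ℕ) (ρ : Subset n → ℕ) : Set where
  field
    rk-⊆S   : ∀ X → X ⊆ S → ρ X ≡ ∣ X ∩ S ∣
    rk-short : ∀ X {x} → x ∈ X → x ∉ S → ∣ X ∩ S ∣ < k → ρ X ≡ suc ∣ X ∩ S ∣
    rk-long  : ∀ X {x} → x ∈ X → x ∉ S → k ≤ ∣ X ∩ S ∣ → ρ X ≡ ∣ X ∩ S ∣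

T-minimalRank : ∀ k m → MinimalRank (pathEdges k m) k (T-rank k m)
T-minimalRank k m = record
  { rk-⊆S    = λ Y Y⊆S → trans (T-rank≡ Y)
      (trans (cong (λ b → ∣ Y ∩ pathEdges k m ∣ + 𝟙 (b ∧ not (allTrue k (chosen Y)))) (⊆path⇒¬parallelChosen Y Y⊆S))
             (+-identityʳ _))
  ; rk-short = λ Y x∈Y x∉S short → trans (T-rank≡ Y)
      (trans (cong₂ (λ b c → ∣ Y ∩ pathEdges k m ∣ + 𝟙 (b ∧ not c)) (∉path⇒parallelChosen Y x∈Y x∉S) (short⇒¬allChosen Y short))
             (+-comm _ 1))
  ; rk-long  = λ Y x∈Y x∉S long → trans (T-rank≡ Y)
      (trans (cong₂ (λ b c → ∣ Y ∩ pathEdges k m ∣ + 𝟙 (b ∧ not c)) (∉path⇒parallelChosen Y x∈Y x∉S) (long⇒allChosen Y long))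
             (+-identityʳ _))
  }
  where open MinimalGraph k m

module Relabelling {n m : ℕ} (σ : Permutation n m) where

  lookup-image : ∀ X y → lookup (image σ X) y ≡ lookup X (σ ⟨$⟩ˡ y)
  lookup-image X y = lookup∘tabulate (λ y → lookup X (σ ⟨$⟩ˡ y)) y

  image-∩ : ∀ X Y → image σ (X ∩ Y) ≡ image σ X ∩ image σ Y
  image-∩ X Y = subset-ext λ y → trans (lookup-image (X ∩ Y) y)
    (trans (lookup-∩ X Y _) (sym (trans (lookup-∩ (image σ X) (image σ Y) y) (cong₂ _∧_ (lookup-image X y) (lookup-image Y y)))))

  ∈image⁺ : ∀ {X x} → x ∈ X → σ ⟨$⟩ʳ x ∈ image σ X
  ∈image⁺ {X} {x} x∈X = lookup⇒∈ (trans (lookup-image X _) (trans (cong (lookup X) (inverseˡ σ)) (∈⇒lookup x∈X)))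

  ∈image⁻ : ∀ {X y} → y ∈ image σ X → σ ⟨$⟩ˡ y ∈ X
  ∈image⁻ {X} {y} y∈ = lookup⇒∈ (trans (sym (lookup-image X y)) (∈⇒lookup y∈))

  ∉image⁺ : ∀ {X x} → x ∉ X → σ ⟨$⟩ʳ x ∉ image σ X
  ∉image⁺ {X} {x} x∉X y∈ = x∉X (subst (_∈ X) (inverseˡ σ) (∈image⁻ y∈))

  image-⊆ : ∀ {X Y} → X ⊆ Y → image σ X ⊆ image σ Y
  image-⊆ {X} {Y} X⊆Y {y} y∈ = subst (_∈ image σ Y) (inverseʳ σ) (∈image⁺ (X⊆Y (∈image⁻ y∈)))

  ∣Z∣≡sum : ∀ {l} (Z : Subset l) → ∣ Z ∣ ≡ sum (𝟙 ∘ lookup Z)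
  ∣Z∣≡sum []          = refl
  ∣Z∣≡sum (true  ∷ Z) = cong suc (∣Z∣≡sum Z)
  ∣Z∣≡sum (false ∷ Z) = ∣Z∣≡sum Z

  ∣image∣ : ∀ X → ∣ image σ X ∣ ≡ ∣ X ∣
  ∣image∣ X = begin
    ∣ image σ X ∣                                      ≡⟨ ∣Z∣≡sum (image σ X) ⟩
    sum (𝟙 ∘ lookup (image σ X))                       ≡⟨ sum-cong-≗ {m} (cong 𝟙 ∘ lookup-image X) ⟩
    sum (λ y → 𝟙 (lookup X (σ ⟨$⟩ˡ y)))                ≡⟨ sum-permute (λ y → 𝟙 (lookup X (σ ⟨$⟩ˡ y))) σ ⟩
    sum (λ x → 𝟙 (lookup X (σ ⟨$⟩ˡ (σ ⟨$⟩ʳ x))))       ≡⟨ sum-cong-≗ {n} (λ x → cong (𝟙 ∘ lookup X) (inverseˡ σ {x})) ⟩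
    sum (𝟙 ∘ lookup X)                                 ≡⟨ ∣Z∣≡sum X ⟨
    ∣ X ∣                                              ∎
    where open ≡-Reasoning

  ∣image∩∣ : ∀ {S S′} → image σ S ≡ S′ → ∀ X → ∣ image σ X ∩ S′ ∣ ≡ ∣ X ∩ S ∣
  ∣image∩∣ {S} refl X = trans (cong ∣_∣ (sym (image-∩ X S))) (∣image∣ (X ∩ S))

  MinimalRank-transport : ∀ {S S′ k ρ ρ′} → image σ S ≡ S′ → MinimalRank S k ρ → MinimalRank S′ k ρ′ →
                          ∀ X → ρ′ (image σ X) ≡ ρ X
  MinimalRank-transport {S} {S′} {k} {ρ} {ρ′} σS≡S′ minρ minρ′ X
    with any? (λ x → (x ∈? X) ×-dec (¬? (x ∈? S)))
  ... | no  none = begin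
    ρ′ (image σ X)          ≡⟨ MinimalRank.rk-⊆S minρ′ (image σ X) (subst (image σ X ⊆_) σS≡S′ (image-⊆ X⊆S)) ⟩
    ∣ image σ X ∩ S′ ∣      ≡⟨ (∣image∩∣ σS≡S′ X) ⟩
    ∣ X ∩ S ∣               ≡⟨ MinimalRank.rk-⊆S minρ X X⊆S ⟨
    ρ X                     ∎
    where
    open ≡-Reasoning
    X⊆S : X ⊆ S
    X⊆S {x} x∈X with x ∈? S
    ... | yes x∈S = x∈S
    ... | no  x∉S = ⊥-elim (none (x , x∈X , x∉S))
  ... | yes (x , x∈X , x∉S) with ∣ X ∩ S ∣ <? k
  ...   | yes short = trans (MinimalRank.rk-short minρ′ (image σ X) (∈image⁺ x∈X) σx∉S′ (subst (_< k) (sym (∣image∩∣ σS≡S′ X)) short))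
                            (trans (cong suc (∣image∩∣ σS≡S′ X)) (sym (MinimalRank.rk-short minρ X x∈X x∉S short)))
    where σx∉S′ = subst (σ ⟨$⟩ʳ x ∉_) σS≡S′ (∉image⁺ x∉S)
  ...   | no  long  = trans (MinimalRank.rk-long minρ′ (image σ X) (∈image⁺ x∈X) σx∉S′ (subst (k ≤_) (sym (∣image∩∣ σS≡S′ X)) (≮⇒≥ long)))
                            (trans (∣image∩∣ σS≡S′ X) (sym (MinimalRank.rk-long minρ X x∈X x∉S (≮⇒≥ long))))
    where σx∉S′ = subst (σ ⟨$⟩ʳ x ∉_) σS≡S′ (∉image⁺ x∉S)

module Sorting where

  toℕ-punchIn : ∀ {l} (c : Fin (suc l)) (y : Fin l) →
                (toℕ y < toℕ c × toℕ (punchIn c y) ≡ toℕ y) ⊎ (toℕ c ≤ toℕ y × toℕ (punchIn c y) ≡ suc (toℕ y))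
  toℕ-punchIn zero    y       = inj₂ (z≤n , refl)
  toℕ-punchIn (suc c) zero    = inj₁ (s≤s z≤n , refl)
  toℕ-punchIn (suc c) (suc y) with toℕ-punchIn c y
  ... | inj₁ (y<c , eq) = inj₁ (s≤s y<c , cong suc eq)
  ... | inj₂ (c≤y , eq) = inj₂ (s≤s c≤y , cong suc eq)

  <ᵇ-punchIn : ∀ {l} (c : Fin (suc l)) (y : Fin l) → (toℕ (punchIn c y) <ᵇ toℕ c) ≡ (toℕ y <ᵇ toℕ c)
  <ᵇ-punchIn c y with toℕ-punchIn c y
  ... | inj₁ (_   , eq) = cong (_<ᵇ toℕ c) eq
  ... | inj₂ (c≤y , eq) = trans (cong (_<ᵇ toℕ c) eq)
                                (trans (≤ᵇ-false {suc (suc (toℕ y))} (<⇒≱ (s≤s (m≤n⇒m≤1+n c≤y))))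
                                       (sym (≤ᵇ-false {suc (toℕ y)} (<⇒≱ (s≤s c≤y)))))

  n<ᵇn≡false : ∀ l → (l <ᵇ l) ≡ false
  n<ᵇn≡false l = ≤ᵇ-false {suc l} (<-irrefl refl)

  sorting : (S : Subset n) → Σ (Permutation n n) λ σ → ∀ x → lookup S x ≡ (toℕ (σ ⟨$⟩ʳ x) <ᵇ ∣ S ∣)
  sorting []          = Perm.id , λ ()
  sorting (true ∷ S)  with sorting S
  ... | σ , sorts = Perm.lift₀ σ , λ { zero → refl ; (suc x) → sorts x }
  sorting {suc n} (false ∷ S) with sorting S
  ... | σ , sorts = Perm.insert zero c σ , λ
    { zero    → sym (subst (λ t → (t <ᵇ ∣ S ∣) ≡ false) (sym (toℕ-fromℕ< (s≤s (∣p∣≤n S)))) (n<ᵇn≡false ∣ S ∣))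
    ; (suc x) → trans (sorts x) (sym (subst (λ t → (toℕ (punchIn c (σ ⟨$⟩ʳ x)) <ᵇ t) ≡ (toℕ (σ ⟨$⟩ʳ x) <ᵇ t))
                                            (toℕ-fromℕ< (s≤s (∣p∣≤n S))) (<ᵇ-punchIn c (σ ⟨$⟩ʳ x))))
    }
    where
    c : Fin (suc n)
    c = fromℕ< (s≤s (∣p∣≤n S))

  image-sorting : ∀ (S : Subset n) → image (proj₁ (sorting S)) S ≡ pathEdges ∣ S ∣ n
  image-sorting S = subset-ext λ y → trans (lookup∘tabulate _ y)
    (trans (proj₂ (sorting S) _) (trans (cong (λ z → toℕ z <ᵇ ∣ S ∣) (inverseʳ (proj₁ (sorting S))))
                                        (sym (lookup∘tabulate (λ j → toℕ j <ᵇ ∣ S ∣) y))))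

-- Connected split matroids

zero⊎small⊎≥3 : ∀ a → a ≡ 0 ⊎ (a ≡ 1 ⊎ a ≡ 2) ⊎ 3 ≤ a
zero⊎small⊎≥3 0             = inj₁ refl
zero⊎small⊎≥3 1             = inj₂ (inj₁ (inj₁ refl))
zero⊎small⊎≥3 2             = inj₂ (inj₁ (inj₂ refl))
zero⊎small⊎≥3 (suc (suc (suc a))) = inj₂ (inj₂ (s≤s (s≤s (s≤s z≤n))))

module ConnectedSplitMatroid {n : ℕ} (M : Matroid n)
  (connectedSplit : ConnectedSplit M)
  (noLoop : ∀ e → ¬ Loop (toData M) e)
  (noColoop : ∀ e → ¬ Coloop (toData M) e)
  (minorHasLoopOrColoop : ∀ e → HasLoopOrColoop (contract (toData M) e) ⊎ HasLoopOrColoop (delete (toData M) e))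
  where

  open RankFunction M
  open Flats M
  open Duality M

  R : ℕ
  R = r ⊤

  rk-⁅e⁆≡1 : ∀ e → r ⁅ e ⁆ ≡ 1
  rk-⁅e⁆≡1 e with r ⁅ e ⁆ in eq | rk-⁅x⁆≤1 e
  ... | zero        | _      = ⊥-elim (noLoop e (⊆⊤ (x∈⁅x⁆ e) , ⊆⊤ , subst₂ _<_ (sym eq) (sym (∣⁅x⁆∣≡1 e)) (s≤s z≤n)))
  ... | suc zero    | _      = refl
  ... | suc (suc _) | s≤s ()

  rk[⊤-e]≡R : ∀ e → r (⊤ - e) ≡ R
  rk[⊤-e]≡R e with r (⊤ - e) <? R
  ... | yes drop    = ⊥-elim (noColoop e (Restriction.rk-drop⇒coloop ⊤ (⊆⊤ (x∈⁅x⁆ e)) drop))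
  ... | no  no-drop = ≤-antisym (mono ⊆⊤) (≤-pred (≰⇒> no-drop))

  split : IsSplit
  split = split⇒IsSplit (proj₂ connectedSplit)

  open Loopless rk-⁅e⁆≡1
  module DualLoopless = Dual.Loopless (coloopless⇒r*-loopless rk[⊤-e]≡R)

  private
    ∈⊤-e⇒≢e : ∀ {e f : Fin n} → f ∈ ⊤ - e → ¬ f ≡ e
    ∈⊤-e⇒≢e {e} f∈ refl = x∉p-x ⊤ e f∈

  contraction-loop⇒parallel : ∀ {e f} → Loop (contract (toData M) e) f → Parallel e f
  contraction-loop⇒parallel {e} {f} (f∈ , _ , dependent) = ∈⊤-e⇒≢e f∈ , (begin
    r (⁅ e ⁆ ∪ ⁅ f ⁆) ≡⟨ cong r (∪-comm ⁅ e ⁆ ⁅ f ⁆) ⟩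
    r (⁅ f ⁆ ∪ ⁅ e ⁆) ≤⟨ m∸n≡0⇒m≤n (n<1⇒n≡0 (subst (r (⁅ f ⁆ ∪ ⁅ e ⁆) ∸ r ⁅ e ⁆ <_) (∣⁅x⁆∣≡1 f) dependent)) ⟩
    r ⁅ e ⁆           ≡⟨ rk-⁅e⁆≡1 e ⟩
    1                 ∎)
    where open ≤-Reasoning

  -- `contract (toData M) e` is the restriction of the matroid `contraction M e` to ⊤ - e.
  contraction-coloopless : ∀ {e f} → ¬ Coloop (contract (toData M) e) f
  contraction-coloopless {e} {f} coloop = <⇒≱ (RankFunction.Restriction.coloop⇒rk-drop (contraction M e) (⊤ - e) coloop)
    (∸-monoˡ-≤ (r ⁅ e ⁆) (begin
      r ((⊤ - e) ∪ ⁅ e ⁆)      ≤⟨ mono ⊆⊤ ⟩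
      r ⊤                      ≡⟨ rk[⊤-e]≡R f ⟨
      r (⊤ - f)                ≤⟨ mono (⊆-solve [] (⊤ₑ ─ₑ v₁) (((⊤ₑ ─ₑ v₀) ─ₑ v₁) ∪ₑ v₀) (⁅ e ⁆ ∷ ⁅ f ⁆ ∷ []) refl tt) ⟩
      r ((⊤ - e - f) ∪ ⁅ e ⁆)  ∎))
    where open ≤-Reasoning

  deletion-loopless : ∀ {e f} → ¬ Loop (delete (toData M) e) f
  deletion-loopless {e} {f} (_ , _ , dependent) = <-irrefl refl (subst₂ _<_ (rk-⁅e⁆≡1 f) (∣⁅x⁆∣≡1 f) dependent)

  deletion-coloop⇒series : ∀ {e f} → Coloop (delete (toData M) e) f → Series e f
  deletion-coloop⇒series {e} {f} coloop =
    ∈⊤-e⇒≢e (proj₁ coloop) , subst (r (⊤ - e - f) <_) (rk[⊤-e]≡R e) (Restriction.coloop⇒rk-drop (⊤ - e) coloop)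

  parallel-or-series : ∀ e → ∃ (Parallel e) ⊎ ∃ (Series e)
  parallel-or-series e with minorHasLoopOrColoop e
  ... | inj₁ (f , inj₁ loop)   = inj₁ (f , contraction-loop⇒parallel loop)
  ... | inj₁ (f , inj₂ coloop) = ⊥-elim (contraction-coloopless coloop)
  ... | inj₂ (f , inj₁ loop)   = ⊥-elim (deletion-loopless loop)
  ... | inj₂ (f , inj₂ coloop) = inj₂ (f , deletion-coloop⇒series coloop)

  module _ (3≤R : 3 ≤ R) (3≤corank : 3 ≤ n ∸ R) where

    ∃parallelPair : ∃ λ p → ∃ (Parallel p)
    ∃parallelPair with any? (λ e → any? (λ f → ¬? (f ≟ᶠ e) ×-dec (r (⁅ e ⁆ ∪ ⁅ f ⁆) ≤? 1)))
    ... | yes (e , f , e∥f) = e , f , e∥f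
    ... | no  none          = ⊥-elim (<⇒≱ (≤-trans 3≤corank (≤-reflexive (sym r*⊤≡corank))) r*⊤≤2)
      where
      everywhere-dual-parallel : ∀ e → ∃ (Dual.Parallel e)
      everywhere-dual-parallel e with parallel-or-series e
      ... | inj₁ (f , e∥f)     = ⊥-elim (none (e , f , e∥f))
      ... | inj₂ (f , series) = f , series⇒dual-parallel series
      r*⊤≤2 : r* ⊤ ≤ 2
      r*⊤≤2 = DualLoopless.everywhere-parallel⇒rank≤2 (split⇒dual-split split) everywhere-dual-parallel

    module ParallelClass {p p′ : Fin n} (p∥p′ : Parallel p p′) where

      P : Subset n
      P = parallelClass p

      S : Subset n
      S = ∁ P

      p∈P : p ∈ P
      p∈P = e∈parallelClass p

      rk-⁅x⁆∪⁅y⁆≤1 : ∀ {x y} → x ∈ P → y ∈ P → r (⁅ x ⁆ ∪ ⁅ y ⁆) ≤ 1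
      rk-⁅x⁆∪⁅y⁆≤1 {x} {y} x∈P y∈P =
        ≤-trans (mono (⊆-solve ((v₁ , v₀) ∷ (v₂ , v₀) ∷ []) (v₁ ∪ₑ v₂) v₀ (P ∷ ⁅ x ⁆ ∷ ⁅ y ⁆ ∷ []) refl
                               (x∈p⇒⁅x⁆⊆p x∈P , x∈p⇒⁅x⁆⊆p y∈P , tt)))
                (rk-parallelClass≤1 p)

      P⊆cl : ∀ {A q} → q ∈ A → q ∈ P → r (A ∪ P) ≤ r A
      P⊆cl {A} {q} q∈A q∈P = ⊆cl⇒rk-∪≤ λ y y∈P →
        ∈cl-mono y (x∈p⇒⁅x⁆⊆p q∈A) (subst (r (⁅ q ⁆ ∪ ⁅ y ⁆) ≤_) (sym (rk-⁅e⁆≡1 q)) (rk-⁅x⁆∪⁅y⁆≤1 q∈P y∈P))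

      outside-no-parallel : ∀ {x x′} → x ∉ P → ¬ Parallel x x′
      outside-no-parallel x∉P x∥x′ = <⇒≱ 3≤R (two-parallel-classes⇒rank≤2 split p∥p′ x∥x′ (x∉P ∘ ∈parallelClass⁺))

      outside-series : ∀ s → s ∉ P → ∃ (Series s)
      outside-series s s∉P with parallel-or-series s
      ... | inj₁ (_ , s∥) = ⊥-elim (outside-no-parallel s∉P s∥)
      ... | inj₂ series   = series

      -- Some z ∈ P other than f spans f, so deleting s and f does not drop the rank.
      series-outside : ∀ {s f} → s ∉ P → Series s f → f ∉ P
      series-outside {s} {f} s∉P (_ , drop) f∈P with ∃parallel-avoiding p∥p′ f
      ... | z , z∈P , z≢f = <⇒≱ drop (begin
        R                          ≡⟨ rk[⊤-e]≡R s ⟨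
        r (⊤ - s)                  ≤⟨ mono (⊆-solve [] (⊤ₑ ─ₑ v₀) (((⊤ₑ ─ₑ v₀) ─ₑ v₁) ∪ₑ v₁) ρ refl tt) ⟩
        r ((⊤ - s - f) ∪ ⁅ f ⁆)     ≤⟨ ∈cl-mono f z⊆ (subst (r (⁅ z ⁆ ∪ ⁅ f ⁆) ≤_) (sym (rk-⁅e⁆≡1 z)) (rk-⁅x⁆∪⁅y⁆≤1 z∈P f∈P)) ⟩
        r (⊤ - s - f)              ∎)
        where
        open ≤-Reasoning
        ρ = ⁅ s ⁆ ∷ ⁅ f ⁆ ∷ ⁅ z ⁆ ∷ []
        z⊆ : ⁅ z ⁆ ⊆ ⊤ - s - f
        z⊆ = ⊆-solve ((v₂ , ∁ₑ v₀) ∷ (v₂ , ∁ₑ v₁) ∷ []) v₂ ((⊤ₑ ─ₑ v₀) ─ₑ v₁) ρ refl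
                     (x≢y⇒⁅x⁆⊆∁⁅y⁆ (λ z≡s → s∉P (subst (_∈ P) z≡s z∈P)) , x≢y⇒⁅x⁆⊆∁⁅y⁆ z≢f , tt)

      -- The series class Q of s is a cyclic flat of the dual, so ∁ Q is a cyclic flat of M containing P;
      -- splitness leaves no room between P and ∁ Q.
      outside-pairwise-series : ∀ {s t} → s ∉ P → t ∉ P → ¬ t ≡ s → Series s t
      outside-pairwise-series {s} {t} s∉P t∉P t≢s =
        dual-parallel⇒series (t≢s , Dual.∈parallelClass⁻ (x∉∁p⇒x∈p (t∉P ∘ ∁Q⊆P)))
        where
        Q = Dual.parallelClass s
        s∈Q : s ∈ Q
        s∈Q = Dual.e∈parallelClass s
        ∁Q-flat : IsFlat (∁ Q)
        ∁Q-flat = dual-cyclic⇒∁-flat (DualLoopless.parallelClass-cyclic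
                    (series⇒dual-parallel (proj₂ (outside-series s s∉P))))
        ∁Q-cyclic : IsCyclic (∁ Q)
        ∁Q-cyclic = dual-flat⇒∁-cyclic (DualLoopless.parallelClass-flat s)
        P⊆∁Q : P ⊆ ∁ Q
        P⊆∁Q {y} y∈P with y ∈? Q
        ... | no  y∉Q = x∉p⇒x∈∁p y∉Q
        ... | yes y∈Q = ⊥-elim (series-outside s∉P (dual-parallel⇒series (y≢s , Dual.∈parallelClass⁻ y∈Q)) y∈P)
          where
          y≢s : ¬ y ≡ s
          y≢s y≡s = s∉P (subst (_∈ P) y≡s y∈P)
        ∁Q⊆P : ∁ Q ⊆ P
        ∁Q⊆P {y} y∈∁Q with y ∈? P
        ... | yes y∈P = y∈P
        ... | no  y∉P with split P (∁ Q) (parallelClass-flat p) (parallelClass-cyclic p∥p′) ∁Q-flat ∁Q-cyclic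
                                 (P⊆∁Q , y , y∈∁Q , y∉P)
        ...   | inj₁ P≡⊥  = ⊥-elim (∉⊥ (subst (p ∈_) P≡⊥ p∈P))
        ...   | inj₂ ∁Q≡⊤ = ⊥-elim (x∈p⇒x∉∁p s∈Q (subst (s ∈_) (sym ∁Q≡⊤) (⊆⊤ s∈Q)))

      ∃outside : ∃ λ s → s ∉ P
      ∃outside with any? (λ x → ¬? (x ∈? P))
      ... | yes found = found
      ... | no  none    = ⊥-elim (<⇒≱ 3≤R (≤-trans (mono ⊤⊆P) (≤-trans (rk-parallelClass≤1 p) (s≤s z≤n))))
        where
        ⊤⊆P : ⊤ ⊆ P
        ⊤⊆P {y} _ with y ∈? P
        ... | yes y∈P = y∈P
        ... | no  y∉P = ⊥-elim (none (y , y∉P))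

      module _ {s₀ : Fin n} (s₀∉P : s₀ ∉ P) where

        s₀∈S : s₀ ∈ S
        s₀∈S = x∉p⇒x∈∁p s₀∉P

        p≢s₀ : ¬ p ≡ s₀
        p≢s₀ p≡s₀ = s₀∉P (subst (_∈ P) p≡s₀ p∈P)

        -- All of S - s₀ is in series with s₀, so these elements are coloops of ⊤ - s₀, whose rank is R.
        ∣S∣≤R : ∣ S ∣ ≤ R
        ∣S∣≤R = begin
          ∣ S ∣                                 ≡⟨ x∈p⇒∣p∣≡1+∣p-x∣ s₀∈S ⟩
          1 + ∣ S - s₀ ∣                        ≡⟨ cong (_+ ∣ S - s₀ ∣) (rk-⁅e⁆≡1 p) ⟨
          r ⁅ p ⁆ + ∣ S - s₀ ∣                  ≤⟨ +-monoˡ-≤ ∣ S - s₀ ∣ (mono p∈rest) ⟩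
          r ((⊤ - s₀) ─ (S - s₀)) + ∣ S - s₀ ∣  ≤⟨ coloops⇒rk[D─Y]+∣Y∣≤rk[D] (⊤ - s₀) (S - s₀) coloops ⟩
          r (⊤ - s₀)                            ≡⟨ rk[⊤-e]≡R s₀ ⟩
          R                                     ∎
          where
          open ≤-Reasoning
          p∈rest : ⁅ p ⁆ ⊆ (⊤ - s₀) ─ (S - s₀)
          p∈rest = ⊆-solve ((v₂ , v₁) ∷ (v₂ , ∁ₑ v₀) ∷ []) v₂ ((⊤ₑ ─ₑ v₀) ─ₑ (∁ₑ v₁ ─ₑ v₀))
                           (⁅ s₀ ⁆ ∷ P ∷ ⁅ p ⁆ ∷ []) refl (x∈p⇒⁅x⁆⊆p p∈P , x≢y⇒⁅x⁆⊆∁⁅y⁆ p≢s₀ , tt)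
          coloops : ∀ t → t ∈ S - s₀ → r (⊤ - s₀ - t) < r (⊤ - s₀)
          coloops t t∈ = subst (r (⊤ - s₀ - t) <_) (sym (rk[⊤-e]≡R s₀))
            (proj₂ (outside-pairwise-series s₀∉P (x∈∁p⇒x∉p (p─q⊆p S ⁅ s₀ ⁆ t∈)) (λ { refl → x∉p-x S s₀ t∈ })))

        -- A circuit through p and s₀ meets P only in p, so p is spanned by S; and p spans P.
        R≤rk-S : R ≤ r S
        R≤rk-S with proj₁ connectedSplit p s₀ (⊆⊤ (x∈⁅x⁆ p)) (⊆⊤ (x∈⁅x⁆ s₀)) p≢s₀
        ... | C , circuit , p∈C , s₀∈C = begin
          R                           ≤⟨ mono (⊆-solve [] ⊤ₑ ((∁ₑ v₀ ∪ₑ v₁) ∪ₑ v₀) (P ∷ ⁅ p ⁆ ∷ []) refl tt) ⟩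
          r ((S ∪ ⁅ p ⁆) ∪ P)          ≤⟨ P⊆cl (q⊆p∪q S ⁅ p ⁆ (x∈⁅x⁆ p)) p∈P ⟩
          r (S ∪ ⁅ p ⁆)                ≤⟨ spanned-by-rest-⊆ p∈C (circuit⇒rk[C]≤rk[C-e] circuit p∈C) C⊆S∪p ⟩
          r ((S ∪ ⁅ p ⁆) - p)          ≤⟨ mono (⊆-solve [] ((∁ₑ v₀ ∪ₑ v₁) ─ₑ v₁) (∁ₑ v₀) (P ∷ ⁅ p ⁆ ∷ []) refl tt) ⟩
          r S                         ∎
          where
          open ≤-Reasoning
          C⊆S∪p : C ⊆ S ∪ ⁅ p ⁆
          C⊆S∪p {y} y∈C with y ∈? P
          ... | no  y∉P = p⊆p∪q ⁅ p ⁆ (x∉p⇒x∈∁p y∉P)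
          ... | yes y∈P with y ≟ᶠ p
          ...   | yes refl = q⊆p∪q S ⁅ p ⁆ (x∈⁅x⁆ p)
          ...   | no  y≢p  = ⊥-elim (<⇒≱ (≤-reflexive (sym (trans pair-independent ∣⁅p⁆∪⁅y⁆∣≡2))) (rk-⁅x⁆∪⁅y⁆≤1 p∈P y∈P))
            where
            ρ = C ∷ ⁅ p ⁆ ∷ ⁅ y ⁆ ∷ ⁅ s₀ ⁆ ∷ []
            ∣⁅p⁆∪⁅y⁆∣≡2 : ∣ ⁅ p ⁆ ∪ ⁅ y ⁆ ∣ ≡ 2
            ∣⁅p⁆∪⁅y⁆∣≡2 = trans (x∉p⇒∣p∪⁅x⁆∣≡1+∣p∣ (x≢y⇒x∉⁅y⁆ y≢p)) (cong suc (∣⁅x⁆∣≡1 p))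
            s₀∉ : s₀ ∉ ⁅ p ⁆ ∪ ⁅ y ⁆
            s₀∉ s₀∈ with x∈p∪q⁻ ⁅ p ⁆ ⁅ y ⁆ s₀∈
            ... | inj₁ s₀∈p = p≢s₀ (sym (x∈⁅y⁆⇒x≡y p s₀∈p))
            ... | inj₂ s₀∈y = s₀∉P (subst (_∈ P) (sym (x∈⁅y⁆⇒x≡y y s₀∈y)) y∈P)
            pair⊂C : ⁅ p ⁆ ∪ ⁅ y ⁆ ⊂ C
            pair⊂C = ⊆-solve ((v₁ , v₀) ∷ (v₂ , v₀) ∷ []) (v₁ ∪ₑ v₂) v₀ ρ refl
                              (x∈p⇒⁅x⁆⊆p p∈C , x∈p⇒⁅x⁆⊆p y∈C , tt) , s₀ , s₀∈C , s₀∉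
            pair-independent : r (⁅ p ⁆ ∪ ⁅ y ⁆) ≡ ∣ ⁅ p ⁆ ∪ ⁅ y ⁆ ∣
            pair-independent = proj₂ (proj₂ circuit _ pair⊂C)

        rk-S≡∣S∣ : r S ≡ ∣ S ∣
        rk-S≡∣S∣ = ≤-antisym (rk-card M S) (≤-trans ∣S∣≤R R≤rk-S)

        ∣S∣≡R : ∣ S ∣ ≡ R
        ∣S∣≡R = ≤-antisym ∣S∣≤R (≤-trans R≤rk-S (rk-card M S))

        rk-⊆S : ∀ X → X ⊆ S → r X ≡ ∣ X ∩ S ∣
        rk-⊆S X X⊆S = trans (independent-⊆ X⊆S rk-S≡∣S∣)
          (cong ∣_∣ (sym (≡-solve ((v₀ , v₁) ∷ []) (v₀ ∩ₑ v₁) v₀ (X ∷ S ∷ []) refl refl (X⊆S , tt))))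

        exchange-independent : ∀ {q t} → q ∈ P → t ∈ S → r ((S - t) ∪ ⁅ q ⁆) ≡ ∣ (S - t) ∪ ⁅ q ⁆ ∣
        exchange-independent {q} {t} q∈P t∈S = ≤-antisym (rk-card M B) (begin
          ∣ B ∣         ≡⟨ x∉p⇒∣p∪⁅x⁆∣≡1+∣p∣ (x∈p⇒x∉∁p q∈P ∘ p─q⊆p S ⁅ t ⁆) ⟩
          suc ∣ S - t ∣ ≡⟨ x∈p⇒∣p∣≡1+∣p-x∣ t∈S ⟨
          ∣ S ∣         ≡⟨ ∣S∣≡R ⟩
          R             ≡⟨ rk[⊤-e]≡R t ⟨
          r (⊤ - t)     ≤⟨ mono (⊆-solve [] (⊤ₑ ─ₑ v₂) (((∁ₑ v₀ ─ₑ v₂) ∪ₑ v₁) ∪ₑ v₀) (P ∷ ⁅ q ⁆ ∷ ⁅ t ⁆ ∷ []) refl tt) ⟩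
          r (B ∪ P)     ≤⟨ P⊆cl (q⊆p∪q (S - t) ⁅ q ⁆ (x∈⁅x⁆ q)) q∈P ⟩
          r B           ∎)
          where
          open ≤-Reasoning
          B = (S - t) ∪ ⁅ q ⁆

        -- Adding one parallel element q to X ∩ S spans X, and (X ∩ S) ∪ ⁅ q ⁆ is independent as
        -- it lies in the basis (S - t) ∪ ⁅ q ⁆ for any t ∈ S outside X.
        rk-short : ∀ X {q} → q ∈ X → q ∉ S → ∣ X ∩ S ∣ < R → r X ≡ suc ∣ X ∩ S ∣
        rk-short X {q} q∈X q∉S short with any? (λ t → (t ∈? S) ×-dec (¬? (t ∈? X)))
        ... | no  none = ⊥-elim (<⇒≱ short (subst (_≤ ∣ X ∩ S ∣) ∣S∣≡R (p⊆q⇒∣p∣≤∣q∣ S⊆X∩S)))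
          where
          S⊆X∩S : S ⊆ X ∩ S
          S⊆X∩S {t} t∈S with t ∈? X
          ... | yes t∈X = x∈p∩q⁺ (t∈X , t∈S)
          ... | no  t∉X = ⊥-elim (none (t , t∈S , t∉X))
        ... | yes (t , t∈S , t∉X) = begin
          r X                  ≡⟨ rk-X≡rk-A ⟩
          r A                  ≡⟨ independent-⊆ A⊆B (exchange-independent q∈P t∈S) ⟩
          ∣ A ∣                ≡⟨ x∉p⇒∣p∪⁅x⁆∣≡1+∣p∣ (q∉S ∘ proj₂ ∘ x∈p∩q⁻ X S) ⟩
          suc ∣ X ∩ S ∣        ∎
          where
          open ≡-Reasoning
          q∈P : q ∈ P
          q∈P = x∉∁p⇒x∈p q∉S
          ρ = X ∷ P ∷ ⁅ q ⁆ ∷ ⁅ t ⁆ ∷ []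
          A B : Subset n
          A = (X ∩ S) ∪ ⁅ q ⁆
          B = (S - t) ∪ ⁅ q ⁆
          q∈A : q ∈ A
          q∈A = q⊆p∪q (X ∩ S) ⁅ q ⁆ (x∈⁅x⁆ q)
          rk-X≡rk-A : r X ≡ r A
          rk-X≡rk-A = ≤-antisym
            (≤-trans (mono (⊆-solve [] v₀ (((v₀ ∩ₑ ∁ₑ v₁) ∪ₑ v₂) ∪ₑ v₁) ρ refl tt)) (P⊆cl q∈A q∈P))
            (mono (⊆-solve ((v₂ , v₀) ∷ []) ((v₀ ∩ₑ ∁ₑ v₁) ∪ₑ v₂) v₀ ρ refl (x∈p⇒⁅x⁆⊆p q∈X , tt)))
          A⊆B : A ⊆ B
          A⊆B = ⊆-solve ((v₃ , ∁ₑ v₀) ∷ []) ((v₀ ∩ₑ ∁ₑ v₁) ∪ₑ v₂) ((∁ₑ v₁ ─ₑ v₃) ∪ₑ v₂) ρ refl (x∉p⇒⁅x⁆⊆∁p t∉X , tt)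

        rk-long : ∀ X {q} → q ∈ X → q ∉ S → R ≤ ∣ X ∩ S ∣ → r X ≡ ∣ X ∩ S ∣
        rk-long X _ _ long = ≤-antisym
          (subst (r X ≤_) (trans (sym ∣S∣≡R) (cong ∣_∣ (sym X∩S≡S))) (mono ⊆⊤))
          (subst (_≤ r X) (trans (cong r X∩S≡S) (trans rk-S≡∣S∣ (cong ∣_∣ (sym X∩S≡S)))) (mono (p∩q⊆p X S)))
          where
          X∩S≡S : X ∩ S ≡ S
          X∩S≡S = ⊆∧∣q∣≤∣p∣⇒p≡q (p∩q⊆q X S) (subst (_≤ ∣ X ∩ S ∣) (sym ∣S∣≡R) long)

        minimalRank : MinimalRank S R r
        minimalRank = record { rk-⊆S = rk-⊆S ; rk-short = rk-short ; rk-long = rk-long }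

        isoToMinimal : IsoToRank M (T-rank R n)
        isoToMinimal = σ , Relabelling.MinimalRank-transport σ σS≡pathEdges minimalRank (T-minimalRank R n)
          where
          σ = proj₁ (Sorting.sorting S)
          σS≡pathEdges : image σ S ≡ pathEdges R n
          σS≡pathEdges = subst (λ k → image σ S ≡ pathEdges k n) ∣S∣≡R (Sorting.image-sorting S)

    minimal : IsoToRank M (T-rank R n)
    minimal with ∃parallelPair
    ... | _ , _ , p∥p′ = ParallelClass.isoToMinimal p∥p′ (proj₂ (ParallelClass.∃outside p∥p′))

  R≤n : R ≤ n
  R≤n = subst (R ≤_) (∣⊤∣≡n n) (rk-card M ⊤)

  0<R : Fin n → 0 < R
  0<R e = subst (_≤ R) (rk-⁅e⁆≡1 e) (mono ⊆⊤)

  0<corank : Fin n → 0 < n ∸ R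
  0<corank e = m<n⇒0<n∸m (begin-strict
    R               ≡⟨ rk[⊤-e]≡R e ⟨
    r (⊤ - e)       ≤⟨ rk-card M (⊤ - e) ⟩
    ∣ ⊤ - e ∣        <⟨ x∈p⇒∣p-x∣<∣p∣ (⊆⊤ (x∈⁅x⁆ e)) ⟩
    ∣ ⊤ {n} ∣        ≡⟨ ∣⊤∣≡n n ⟩
    n               ∎)
    where open ≤-Reasoning

  small⊎minimal : Fin n → ((R ≡ 1 ⊎ R ≡ 2) ⊎ (n ∸ R ≡ 1 ⊎ n ∸ R ≡ 2)) ⊎ IsoToRank M (T-rank R n)
  small⊎minimal e with zero⊎small⊎≥3 R | zero⊎small⊎≥3 (n ∸ R)
  ... | inj₁ R≡0          | _                  = ⊥-elim (<⇒≢ (0<R e) (sym R≡0))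
  ... | inj₂ (inj₁ small) | _                  = inj₁ (inj₁ small)
  ... | inj₂ (inj₂ _)     | inj₁ corank≡0      = ⊥-elim (<⇒≢ (0<corank e) (sym corank≡0))
  ... | inj₂ (inj₂ _)     | inj₂ (inj₁ small)  = inj₁ (inj₂ small)
  ... | inj₂ (inj₂ 3≤R)   | inj₂ (inj₂ 3≤corank) = inj₂ (minimal 3≤R 3≤corank)

proposition3p1 : ∀ {n} (M : Matroid n) →
    ConnectedSplit M →
    (∀ e → ¬ Loop (toData M) e) →
    (∀ e → ¬ Coloop (toData M) e) →
    (∀ e → HasLoopOrColoop (contract (toData M) e) ⊎ HasLoopOrColoop (delete (toData M) e)) →
    ((rankOf M ≡ 1 ⊎ rankOf M ≡ 2) ⊎ (corankOf M ≡ 1 ⊎ corankOf M ≡ 2))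
    ⊎ (∃ λ k → ∃ λ m → k ≤ m × IsoToRank M (T-rank k m))
proposition3p1 {zero} M _ _ _ _ = inj₂ (0 , 0 , z≤n , Perm.id , λ { [] → sym (n≤0⇒n≡0 (rk-card M [])) })
proposition3p1 {suc n} M connectedSplit noLoop noColoop minors =
  map₂ (λ minimal → rankOf M , suc n , R≤n , minimal) (small⊎minimal zero)
  where open ConnectedSplitMatroid M connectedSplit noLoop noColoop minors
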